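{- For $n\geq 1$, $$\sum_{T\in \mathcal P_n}t^{{\rm eld}(T)}\prod_{i=1}^{n}x_i^{{\rm young}_T(i)}=\prod_{k=0}^{n-2}(x_1+\cdots+x_n+kt).$$
   Context: A plane tree on a finite totally ordered set is a rooted tree in which the children of each vertex are linearly ordered (left to right). A vertex $j$ is a descendant of $i$ if the path from the root to $j$ passes through $i$ (each vertex is its own descendant); $\beta_T(i)$ is the smallest descendant of $i$. A child $j$ of $v$ is elder if $v$ has a child $k$ to the right of $j$ with $\beta_T(k)<\beta_T(j)$, and younger otherwise. ${\rm young}_T(v)$ is the number of younger children of $v$ and ${\rm eld}(T)$ is the total number of elder vertices of $T$. $\mathcal P_n$ is the set of all plane trees on $[n]=\{1,\dots,n\}$ (with arbitrary root). Empty products equal $1$. -}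

module Defs where

open import Level using (Level)
open import Data.Nat using (ℕ; zero; suc; _+_; _⊓_; _<ᵇ_; _≡ᵇ_)
open import Data.Bool using (Bool; true; false; if_then_else_)
open import Data.List using (List; []; _∷_; _++_; map; foldr; upTo)
open import Data.Bool.ListAction using (any)
open import Data.List.Relation.Binary.Permutation.Propositional using (_↭_)
open import Algebra.Bundles using (CommutativeSemiring)

-- A plane tree: a root label together with the left-to-right ordered
-- list of the subtrees rooted at its children.
data PTree : Set where
  node : ℕ → List PTree → PTree

mutual
  labels : PTree → List ℕ
  labels (node a cs) = a ∷ labelsF cs

  labelsF : List PTree → List ℕ
  labelsF [] = []
  labelsF (c ∷ cs) = labels c ++ labelsF cs

-- T is a plane tree on [n] = {1,…,n}: its vertex labels are exactly 1,…,n,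
-- each occurring once (any root allowed).
IsPlaneTreeOn : ℕ → PTree → Set
IsPlaneTreeOn n T = labels T ↭ map suc (upTo n)

rootLabel : PTree → ℕ
rootLabel (node a _) = a

-- β_T(i): the smallest descendant of i (the descendants of i are the
-- labels of the subtree rooted at i, including i itself).
β : PTree → ℕ
β T = foldr _⊓_ (rootLabel T) (labels T)

-- a child c (given the list `rest` of its siblings to its right) is elder iff
-- some sibling k to its right has β k < β c
isElder : PTree → List PTree → Bool
isElder c rest = any (λ k → β k <ᵇ β c) rest

youngCount : List PTree → ℕ
youngCount [] = 0
youngCount (c ∷ cs) = (if isElder c cs then 0 else 1) + youngCount cs

elderCount : List PTree → ℕ
elderCount [] = 0
elderCount (c ∷ cs) = (if isElder c cs then 1 else 0) + elderCount cs

mutual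
  eld : PTree → ℕ
  eld (node a cs) = elderCount cs + eldF cs

  eldF : List PTree → ℕ
  eldF [] = 0
  eldF (c ∷ cs) = eld c + eldF cs

mutual
  -- young_T(i): number of younger children of the vertex labelled i
  -- (labels are distinct in trees on [n]; 0 if i does not occur)
  young : PTree → ℕ → ℕ
  young (node a cs) i = (if a ≡ᵇ i then youngCount cs else 0) + youngF cs i

  youngF : List PTree → ℕ → ℕ
  youngF [] i = 0
  youngF (c ∷ cs) i = young c i + youngF cs i

module _ {c ℓ : Level} (R : CommutativeSemiring c ℓ) where
  open CommutativeSemiring R using (Carrier; 0#; 1#) renaming (_+_ to _⊕_; _*_ to _⊛_)

  pow : Carrier → ℕ → Carrier
  pow a zero = 1#
  pow a (suc k) = a ⊛ pow a k

  times : ℕ → Carrier → Carrier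
  times zero a = 0#
  times (suc k) a = a ⊕ times k a

  sumOver : {A : Set} → (A → Carrier) → List A → Carrier
  sumOver f [] = 0#
  sumOver f (a ∷ as) = f a ⊕ sumOver f as

  prodOver : {A : Set} → (A → Carrier) → List A → Carrier
  prodOver f [] = 1#
  prodOver f (a ∷ as) = f a ⊛ prodOver f as

{-# OPTIONS --safe #-}
-- Removing the largest leaf of a plane tree on S, recording its parent p and its position j among the
-- children of p, and repeating, encodes the tree by a Prüfer-type code; the codes are exactly the
-- sequences of pairs (p , j) with p ∈ S and j at most the number of later occurrences of p, i.e. the
-- number of children p has when the leaf is grafted back.  Grafting back a leaf l that exceeds every leaf
-- of the smaller tree other than p changes the status of no old vertex, since every subtree off the path
-- from the root to p has its minimum below l; the new leaf is younger exactly when it is the last child of p.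
-- So t^eld ∏ x_i^young is the product over the code of x_p (last position) or t (each of the d_p
-- earlier positions), and summing over the positions and over p ∈ S, where the d_p add up to the k
-- edges of the smaller tree, contributes the factor x_1 + ⋯ + x_n + k t.
module Submission where

open import Defs
open import Data.Nat using (ℕ; zero; suc; _+_; _≤_; _<_; _∸_; _⊓_; _≡ᵇ_; _<ᵇ_; z≤n; s≤s)
open import Data.Nat.Properties
  using ( _≟_; ≡ᵇ⇒≡; ≡⇒≡ᵇ; <ᵇ⇒<; <⇒<ᵇ; <ᵇ-reflects-<; ≤-trans; ≤-reflexive; m≤m+n; m≤n+m
        ; n≤0⇒n≡0; ≮⇒≥; <-irrefl; +-monoʳ-≤)
import Data.Nat.Properties as ℕ
open import Data.Bool using (Bool; true; false; if_then_else_; _∨_)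
open import Data.Bool.Properties using (T-≡; ¬-not)
open import Data.Bool.ListAction using (any)
open import Data.List using (List; []; _∷_; _++_; length; map; foldr; filter; concatMap; upTo; downFrom; drop)
open import Data.List.Membership.Propositional using (_∈_; _∉_; find; lose)
open import Data.List.Properties using (∷-injectiveˡ; ∷-injectiveʳ; filter-≐; length-map; upTo-∷ʳ; length-upTo)
open import Data.List.Extrema.Nat using (max; argmax-sel; xs≤max)
open import Data.List.Membership.Propositional.Properties
  using ( ∈-map⁺; ∈-map⁻; ∈-++⁺ˡ; ∈-++⁺ʳ; ∈-++⁻; ∈-filter⁺; ∈-filter⁻; ∈-concatMap⁺; ∈-concatMap⁻
        ; ∈-downFrom⁺; ∈-downFrom⁻; foldr-selective)
open import Data.List.Relation.Unary.Any using (here; there; any?)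
open import Data.List.Relation.Unary.All as All using (All; []; _∷_)
open import Data.List.Relation.Unary.Unique.Propositional using (Unique; []; _∷_)
import Data.List.Relation.Unary.Unique.Propositional.Properties as Unique
open import Data.List.Relation.Unary.Unique.Propositional.Properties using (downFrom⁺)
import Data.List.Relation.Unary.AllPairs as AllPairs
import Data.List.Relation.Unary.AllPairs.Properties as AllPairs
open import Data.List.Relation.Binary.Permutation.Propositional as ↭ using (_↭_; ↭⇒↭ₛ′)
open import Data.List.Relation.Binary.Permutation.Propositional.Properties using (map⁺; ↭-length; ∈-resp-↭)
open import Data.List.Relation.Binary.Permutation.Setoid.Properties using (foldr-commMonoid)
open import Data.List.Relation.Binary.BagAndSetEquality using (∼bag⇒↭)
open import Data.List.Membership.Propositional.Properties.WithK using (unique∧set⇒bag)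
open import Data.List.Relation.Unary.All.Properties using (All¬⇒¬Any; ¬Any⇒All¬)
import Data.List.Relation.Unary.All.Properties as All
open import Data.Nat.ListAction using (sum)
open import Data.Product using (∃-syntax; _×_; _,_; proj₁; proj₂)
open import Data.Sum using (_⊎_; inj₁; inj₂)
open import Data.Unit using (⊤; tt)
open import Function using (_∘_)
open import Function.Bundles using (_⇔_; mk⇔; Equivalence)
open import Relation.Nullary using (¬_; contradiction; yes; no)
open import Relation.Nullary.Reflects using (Reflects; ofʸ; ofⁿ)
open import Relation.Nullary.Decidable using (proof)
open import Relation.Binary.PropositionalEquality
  using (_≡_; _≢_; refl; sym; trans; cong; cong₂; subst; module ≡-Reasoning)
open import Algebra.Bundles using (CommutativeSemiring)
import Algebra.Properties.CommutativeSemigroup as CommSemigroupProperties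

open CommSemigroupProperties ℕ.+-commutativeSemigroup using (x∙yz≈y∙xz; interchange)

≡ᵇ-reflects : ∀ m n → Reflects (m ≡ n) (m ≡ᵇ n)
≡ᵇ-reflects m n = proof (m ≟ n)

≡ᵇ-refl : ∀ n → (n ≡ᵇ n) ≡ true
≡ᵇ-refl n = Equivalence.to T-≡ (≡⇒≡ᵇ n n refl)

≢⇒≡ᵇ-false : ∀ {m n} → m ≢ n → (m ≡ᵇ n) ≡ false
≢⇒≡ᵇ-false {m} {n} m≢n = ¬-not (m≢n ∘ ≡ᵇ⇒≡ m n ∘ Equivalence.from T-≡)

<⇒<ᵇ-true : ∀ {m n} → m < n → (m <ᵇ n) ≡ true
<⇒<ᵇ-true m<n = Equivalence.to T-≡ (<⇒<ᵇ m<n)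

≮⇒<ᵇ-false : ∀ {m n} → ¬ m < n → (m <ᵇ n) ≡ false
≮⇒<ᵇ-false {m} {n} m≮n = ¬-not (m≮n ∘ <ᵇ⇒< m n ∘ Equivalence.from T-≡)

<ᵇ-cong : ∀ {a b c d} → (a < b ⇔ c < d) → (a <ᵇ b) ≡ (c <ᵇ d)
<ᵇ-cong {a} {b} {c} {d} a<b⇔c<d with a <ᵇ b | <ᵇ-reflects-< a b | c <ᵇ d | <ᵇ-reflects-< c d
... | true  | _       | true  | _       = refl
... | false | _       | false | _       = refl
... | true  | ofʸ a<b | false | ofⁿ c≮d = contradiction (Equivalence.to a<b⇔c<d a<b) c≮d
... | false | ofⁿ a≮b | true  | ofʸ c<d = contradiction (Equivalence.from a<b⇔c<d c<d) a≮b

⊓-<-below : ∀ {m b l} → b < l → (m ⊓ l < b ⇔ m < b)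
⊓-<-below {m} {b} {l} b<l = mk⇔ to (ℕ.≤-<-trans (ℕ.m⊓n≤m m l))
  where
  to : m ⊓ l < b → m < b
  to m⊓l<b with ℕ.⊓-sel m l
  ... | inj₁ m⊓l≡m = subst (_< b) m⊓l≡m m⊓l<b
  ... | inj₂ m⊓l≡l = contradiction (subst (_< b) m⊓l≡l m⊓l<b) (ℕ.<⇒≯ b<l)

<-⊓-below : ∀ {m b l} → m < l → (m < b ⊓ l ⇔ m < b)
<-⊓-below {m} {b} {l} m<l = mk⇔ (λ m<b⊓l → ℕ.<-≤-trans m<b⊓l (ℕ.m⊓n≤m b l)) (λ m<b → ℕ.⊓-glb m<b m<l)

m+n≡1-cases : ∀ m {n} → m + n ≡ 1 → (m ≡ 1 × n ≡ 0) ⊎ (m ≡ 0 × n ≡ 1)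
m+n≡1-cases zero          eq = inj₂ (refl , eq)
m+n≡1-cases (suc zero)    eq = inj₁ (refl , ℕ.suc-injective eq)
m+n≡1-cases (suc (suc m)) ()

n≡0⇒m+n≡m : ∀ m {n} → n ≡ 0 → m + n ≡ m
n≡0⇒m+n≡m m refl = ℕ.+-identityʳ m

m+n≤1⇒n≡0 : ∀ {m n} → m + n ≤ 1 → 0 < m → n ≡ 0
m+n≤1⇒n≡0 {suc zero} {zero} _ _ = refl
m+n≤1⇒n≡0 {suc zero} {suc n} (s≤s ())
m+n≤1⇒n≡0 {suc (suc m)} (s≤s ())

m+n≤1⇒m≡0 : ∀ {m n} → m + n ≤ 1 → 0 < n → m ≡ 0
m+n≤1⇒m≡0 {m} {n} m+n≤1 = m+n≤1⇒n≡0 (subst (_≤ 1) (ℕ.+-comm m n) m+n≤1)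

sum-map-+ : ∀ {A : Set} (f g : A → ℕ) xs → sum (map (λ a → f a + g a) xs) ≡ sum (map f xs) + sum (map g xs)
sum-map-+ f g []       = refl
sum-map-+ f g (a ∷ xs) = trans (cong (f a + g a +_) (sum-map-+ f g xs)) (interchange (f a) (g a) _ _)

length≤sum : ∀ {A : Set} (f : A → ℕ) xs → All (λ a → 0 < f a) xs → length xs ≤ sum (map f xs)
length≤sum f []       []           = z≤n
length≤sum f (a ∷ xs) (0<fa ∷ pos) = ℕ.+-mono-≤ 0<fa (length≤sum f xs pos)

length≡0⇒[] : ∀ {A : Set} (xs : List A) → length xs ≡ 0 → xs ≡ []
length≡0⇒[] [] _ = refl

insertAt : {A : Set} → ℕ → A → List A → List A
insertAt zero    y xs       = y ∷ xs
insertAt (suc j) y []       = y ∷ []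
insertAt (suc j) y (x ∷ xs) = x ∷ insertAt j y xs

length-insertAt : ∀ {A : Set} j (y : A) xs → length (insertAt j y xs) ≡ suc (length xs)
length-insertAt zero    y xs       = refl
length-insertAt (suc j) y []       = refl
length-insertAt (suc j) y (x ∷ xs) = cong suc (length-insertAt j y xs)

insertAt-additive : ∀ {A : Set} (F : List A → ℕ) (f : A → ℕ) → (∀ x xs → F (x ∷ xs) ≡ f x + F xs) →
                    ∀ j y xs → F (insertAt j y xs) ≡ f y + F xs
insertAt-additive F f F-∷ zero    y xs       = F-∷ y xs
insertAt-additive F f F-∷ (suc j) y []       = F-∷ y []
insertAt-additive F f F-∷ (suc j) y (x ∷ xs) = begin
  F (x ∷ insertAt j y xs)     ≡⟨ F-∷ x _ ⟩
  f x + F (insertAt j y xs)   ≡⟨ cong (f x +_) (insertAt-additive F f F-∷ j y xs) ⟩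
  f x + (f y + F xs)          ≡⟨ x∙yz≈y∙xz (f x) (f y) (F xs) ⟩
  f y + (f x + F xs)          ≡⟨ cong (f y +_) (F-∷ x xs) ⟨
  f y + F (x ∷ xs)            ∎
  where open ≡-Reasoning

any-insertAt : ∀ {A : Set} (f : A → Bool) j {y} xs → f y ≡ false → any f (insertAt j y xs) ≡ any f xs
any-insertAt f zero    xs       fy≡false rewrite fy≡false = refl
any-insertAt f (suc j) []       fy≡false rewrite fy≡false = refl
any-insertAt f (suc j) (x ∷ xs) fy≡false = cong (f x ∨_) (any-insertAt f j xs fy≡false)

insertAt-injective : ∀ {A : Set} {y : A} j₁ j₂ xs → y ∉ xs → j₁ ≤ length xs → j₂ ≤ length xs →
                     insertAt j₁ y xs ≡ insertAt j₂ y xs → j₁ ≡ j₂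
insertAt-injective zero      zero      xs       y∉ _        _        eq = refl
insertAt-injective zero      (suc j₂)  (x ∷ xs) y∉ _        _        eq = contradiction (here (∷-injectiveˡ eq)) y∉
insertAt-injective (suc j₁)  zero      (x ∷ xs) y∉ _        _        eq = contradiction (here (sym (∷-injectiveˡ eq))) y∉
insertAt-injective (suc j₁)  (suc j₂)  (x ∷ xs) y∉ (s≤s b₁) (s≤s b₂) eq =
  cong suc (insertAt-injective j₁ j₂ xs (y∉ ∘ there) b₁ b₂ (∷-injectiveʳ eq))

concatMap-unique : ∀ {A B : Set} {f : A → List B} (tag : B → A) → (∀ {x z} → z ∈ f x → tag z ≡ x) →
                   ∀ {xs} → Unique xs → (∀ x → Unique (f x)) → Unique (concatMap f xs)
concatMap-unique {f = f} tag tag-f {xs} uxs uf =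
  Unique.concat⁺ (All.map⁺ (All.universal uf xs))
                 (AllPairs.map⁺ (AllPairs.map (λ x≢y {_} (z∈fx , z∈fy) → x≢y (trans (sym (tag-f z∈fx)) (tag-f z∈fy)))
                                              uxs))

∈-concatMap : ∀ {A B : Set} {f : A → List B} {xs z} → z ∈ concatMap f xs → ∃[ x ] x ∈ xs × z ∈ f x
∈-concatMap {xs = xs} z∈ = find (∈-concatMap⁻ _ {xs = xs} z∈)

map-unique : ∀ {A B : Set} (f : A → B) {xs} → (∀ {a b} → a ∈ xs → b ∈ xs → f a ≡ f b → a ≡ b) →
             Unique xs → Unique (map f xs)
map-unique f inj []           = []
map-unique f inj (x∉xs ∷ uxs) =
  All.map⁺ (All.tabulate λ y∈ fx≡fy → All.lookup x∉xs y∈ (inj (here refl) (there y∈) fx≡fy))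
  ∷ map-unique f (λ a∈ b∈ → inj (there a∈) (there b∈)) uxs

δ : ℕ → ℕ → ℕ
δ m n = if m ≡ᵇ n then 1 else 0

δ-refl : ∀ n → δ n n ≡ 1
δ-refl n rewrite ≡ᵇ-refl n = refl

δ-≢ : ∀ {m n} → m ≢ n → δ m n ≡ 0
δ-≢ m≢n rewrite ≢⇒≡ᵇ-false m≢n = refl

δ-sym : ∀ m n → δ m n ≡ δ n m
δ-sym m n with m ≡ᵇ n | ≡ᵇ-reflects m n
... | true  | ofʸ refl = sym (δ-refl m)
... | false | ofⁿ m≢n = sym (δ-≢ (m≢n ∘ sym))

δ≡1⇒≡ : ∀ {m n} → δ m n ≡ 1 → m ≡ n
δ≡1⇒≡ {m} {n} eq with m ≡ᵇ n | ≡ᵇ-reflects m n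
... | true | ofʸ m≡n = m≡n

δ-≗⇒≡ : ∀ {p q} → (∀ v → δ p v ≡ δ q v) → p ≡ q
δ-≗⇒≡ {p} {q} δp≗δq = sym (δ≡1⇒≡ (trans (sym (δp≗δq p)) (δ-refl p)))

count : ℕ → List ℕ → ℕ
count v []       = 0
count v (a ∷ as) = δ a v + count v as

count-++ : ∀ v xs ys → count v (xs ++ ys) ≡ count v xs + count v ys
count-++ v []       ys = refl
count-++ v (a ∷ xs) ys = trans (cong (δ a v +_) (count-++ v xs ys)) (sym (ℕ.+-assoc (δ a v) _ _))

∈⇒0<count : ∀ {v xs} → v ∈ xs → 0 < count v xs
∈⇒0<count {v} {a ∷ xs} (here refl) = ≤-trans (≤-reflexive (sym (δ-refl v))) (m≤m+n _ _)
∈⇒0<count {v} {a ∷ xs} (there v∈xs) = ≤-trans (∈⇒0<count v∈xs) (m≤n+m _ _)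

0<count⇒∈ : ∀ {v} xs → 0 < count v xs → v ∈ xs
0<count⇒∈ {v} (a ∷ xs) pos with a ≡ᵇ v | ≡ᵇ-reflects a v
... | true  | ofʸ refl = here refl
... | false | _        = there (0<count⇒∈ xs pos)

∉⇒count≡0 : ∀ {v xs} → v ∉ xs → count v xs ≡ 0
∉⇒count≡0 {v} {xs} v∉xs = n≤0⇒n≡0 (≮⇒≥ (v∉xs ∘ 0<count⇒∈ xs))

count≡0⇒∉ : ∀ {v xs} → count v xs ≡ 0 → v ∉ xs
count≡0⇒∉ eq v∈xs = ℕ.<⇒≢ (∈⇒0<count v∈xs) (sym eq)

count-↭ : ∀ v {xs ys} → xs ↭ ys → count v xs ≡ count v ys
count-↭ v ↭.refl             = refl
count-↭ v (↭.prep a xs↭ys)   = cong (δ a v +_) (count-↭ v xs↭ys)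
count-↭ v (↭.swap {xs} {ys} a b xs↭ys) =
  trans (cong (λ n → δ a v + (δ b v + n)) (count-↭ v xs↭ys)) (x∙yz≈y∙xz (δ a v) (δ b v) (count v ys))
count-↭ v (↭.trans p q)      = trans (count-↭ v p) (count-↭ v q)

Unique⇒count≤1 : ∀ {xs} → Unique xs → ∀ v → count v xs ≤ 1
Unique⇒count≤1 {[]}     []           v = z≤n
Unique⇒count≤1 {a ∷ xs} (a∉xs ∷ uxs) v with a ≡ᵇ v | ≡ᵇ-reflects a v
... | true  | ofʸ refl = s≤s (≤-reflexive (∉⇒count≡0 (All¬⇒¬Any a∉xs)))
... | false | _        = Unique⇒count≤1 uxs v

count≤1⇒Unique : ∀ {xs} → (∀ v → count v xs ≤ 1) → Unique xs
count≤1⇒Unique {[]}     _   = []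
count≤1⇒Unique {a ∷ xs} ≤1 = ¬Any⇒All¬ xs a∉xs ∷ count≤1⇒Unique (λ v → ≤-trans (m≤n+m _ _) (≤1 v))
  where
  a∉xs : a ∉ xs
  a∉xs a∈xs = <-irrefl refl (≤-trans (+-monoʳ-≤ 1 (∈⇒0<count a∈xs))
                                     (subst (λ n → n + count a xs ≤ 1) (δ-refl a) (≤1 a)))

count-≗⇒↭ : ∀ {xs ys} → (∀ v → count v xs ≡ count v ys) → Unique ys → xs ↭ ys
count-≗⇒↭ {xs} {ys} xs≗ys uys = ∼bag⇒↭ (unique∧set⇒bag uxs uys (mk⇔ to from))
  where
  uxs : Unique xs
  uxs = count≤1⇒Unique (λ v → subst (_≤ 1) (sym (xs≗ys v)) (Unique⇒count≤1 uys v))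
  to : ∀ {v} → v ∈ xs → v ∈ ys
  to {v} v∈xs = 0<count⇒∈ ys (subst (0 <_) (xs≗ys v) (∈⇒0<count v∈xs))
  from : ∀ {v} → v ∈ ys → v ∈ xs
  from {v} v∈ys = 0<count⇒∈ xs (subst (0 <_) (sym (xs≗ys v)) (∈⇒0<count v∈ys))

count-≡⇒∈ : ∀ {v xs ys} → count v xs ≡ count v ys → v ∈ xs → v ∈ ys
count-≡⇒∈ {ys = ys} eq v∈xs = 0<count⇒∈ ys (subst (0 <_) eq (∈⇒0<count v∈xs))

remove : ℕ → List ℕ → List ℕ
remove l []      = []
remove l (s ∷ S) = if s ≡ᵇ l then remove l S else s ∷ remove l S

remove-absent : ∀ {l} S → count l S ≡ 0 → remove l S ≡ S
remove-absent {l} []      _    = refl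
remove-absent {l} (s ∷ S) l∉sS with s ≡ᵇ l
... | false = cong (s ∷_) (remove-absent S l∉sS)

count-remove : ∀ {l} S → count l S ≡ 1 → ∀ v → δ l v + count v (remove l S) ≡ count v S
count-remove {l} (s ∷ S) l-once v with s ≡ᵇ l | ≡ᵇ-reflects s l
... | true  | ofʸ refl rewrite remove-absent S (ℕ.suc-injective l-once) = refl
... | false | ofⁿ _    = trans (x∙yz≈y∙xz (δ l v) (δ s v) _) (cong (δ s v +_) (count-remove S l-once v))

length-remove : ∀ {l} S → count l S ≡ 1 → length S ≡ suc (length (remove l S))
length-remove {l} (s ∷ S) l-once with s ≡ᵇ l | ≡ᵇ-reflects s l
... | true  | ofʸ refl rewrite remove-absent S (ℕ.suc-injective l-once) = refl
... | false | ofⁿ _    = cong suc (length-remove S l-once)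

sum-δ : ∀ q S → sum (map (δ q) S) ≡ count q S
sum-δ q []      = refl
sum-δ q (s ∷ S) = cong₂ _+_ (δ-sym q s) (sum-δ q S)

sum-count : ∀ {S} Q → Unique S → (∀ {q} → q ∈ Q → q ∈ S) → sum (map (λ v → count v Q) S) ≡ length Q
sum-count {S} []      uS Q⊆S = sum-zero S
  where
  sum-zero : ∀ S → sum (map (λ _ → 0) S) ≡ 0
  sum-zero []      = refl
  sum-zero (_ ∷ S) = sum-zero S
sum-count {S} (q ∷ Q) uS Q⊆S = begin
  sum (map (λ v → δ q v + count v Q) S)             ≡⟨ sum-map-+ (δ q) (λ v → count v Q) S ⟩
  sum (map (δ q) S) + sum (map (λ v → count v Q) S) ≡⟨ cong₂ _+_ (sum-δ q S) (sum-count Q uS (Q⊆S ∘ there)) ⟩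
  count q S + length Q                              ≡⟨ cong (_+ length Q) q-once ⟩
  suc (length Q)                                    ∎
  where
  open ≡-Reasoning
  q-once : count q S ≡ 1
  q-once = ℕ.≤-antisym (Unique⇒count≤1 uS q) (∈⇒0<count (Q⊆S (here refl)))

pigeonhole : ∀ {S} Q → Unique S → (∀ {q} → q ∈ Q → q ∈ S) → length Q < length S → ∃[ v ] v ∈ S × count v Q ≡ 0
pigeonhole {S} Q uS Q⊆S Q<S with any? (λ v → count v Q ≟ 0) S
... | yes unused = find unused
... | no  ¬unused = contradiction (begin-strict
  length Q                       <⟨ Q<S ⟩
  length S                       ≤⟨ length≤sum (λ v → count v Q) S (All.map ℕ.n≢0⇒n>0 (¬Any⇒All¬ S ¬unused)) ⟩
  sum (map (λ v → count v Q) S)  ≡⟨ sum-count Q uS Q⊆S ⟩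
  length Q                       ∎) (ℕ.<-irrefl refl)
  where open ℕ.≤-Reasoning

record LargestZero (f : ℕ → ℕ) (S : List ℕ) (m : ℕ) : Set where
  field
    member  : m ∈ S
    vanishes : f m ≡ 0
    largest : ∀ {v} → v ∈ S → f v ≡ 0 → v ≤ m

-- Junk value 0 when f vanishes nowhere on S.
largestZero : (ℕ → ℕ) → List ℕ → ℕ
largestZero f S = max 0 (filter (λ v → f v ≟ 0) S)

largestZero-cong : ∀ {f g} S → (∀ v → f v ≡ g v) → largestZero f S ≡ largestZero g S
largestZero-cong {f} {g} S f≗g =
  cong (max 0) (filter-≐ (λ v → f v ≟ 0) (λ v → g v ≟ 0) ((λ {v} → trans (sym (f≗g v))) , (λ {v} → trans (f≗g v)))
                         S)

largestZero-spec : ∀ {f S v} → v ∈ S → f v ≡ 0 → LargestZero f S (largestZero f S)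
largestZero-spec {f} {S} {v} v∈S fv≡0 = record
  { member   = proj₁ (∈-filter⁻ P? {xs = S} m∈F)
  ; vanishes = proj₂ (∈-filter⁻ P? {xs = S} m∈F)
  ; largest  = λ w∈S fw≡0 → All.lookup (xs≤max 0 F) (∈-filter⁺ P? w∈S fw≡0)
  }
  where
  P? = λ v → f v ≟ 0
  F  = filter P? S
  v∈F : v ∈ F
  v∈F = ∈-filter⁺ P? v∈S fv≡0
  m∈F : max 0 F ∈ F
  m∈F with argmax-sel (λ n → n) 0 F
  ... | inj₂ m∈F = m∈F
  ... | inj₁ m≡0 = subst (_∈ F) (trans (n≤0⇒n≡0 (subst (v ≤_) m≡0 (All.lookup (xs≤max 0 F) v∈F))) (sym m≡0)) v∈F

module Sums {c ℓ} (R : CommutativeSemiring c ℓ) where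
  open CommutativeSemiring R renaming (_+_ to _⊕_; refl to ≈-refl; sym to ≈-sym; trans to ≈-trans)
  open import Relation.Binary.Reasoning.Setoid setoid
  open CommSemigroupProperties +-commutativeSemigroup using () renaming (interchange to ⊕-interchange)

  module _ {A : Set} where

    sumOver-cong : ∀ {f g : A → Carrier} xs → (∀ {a} → a ∈ xs → f a ≈ g a) → sumOver R f xs ≈ sumOver R g xs
    sumOver-cong []       f≈g = ≈-refl
    sumOver-cong (a ∷ xs) f≈g = +-cong (f≈g (here refl)) (sumOver-cong xs (f≈g ∘ there))

    sumOver-++ : ∀ (f : A → Carrier) xs ys → sumOver R f (xs ++ ys) ≈ sumOver R f xs ⊕ sumOver R f ys
    sumOver-++ f []       ys = ≈-sym (+-identityˡ _)
    sumOver-++ f (a ∷ xs) ys = ≈-trans (+-congˡ (sumOver-++ f xs ys)) (≈-sym (+-assoc _ _ _))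

    sumOver-*ˡ : ∀ k (f : A → Carrier) xs → sumOver R (λ a → k * f a) xs ≈ k * sumOver R f xs
    sumOver-*ˡ k f []       = ≈-sym (zeroʳ k)
    sumOver-*ˡ k f (a ∷ xs) = ≈-trans (+-congˡ (sumOver-*ˡ k f xs)) (≈-sym (distribˡ k _ _))

    sumOver-*ʳ : ∀ k (f : A → Carrier) xs → sumOver R (λ a → f a * k) xs ≈ sumOver R f xs * k
    sumOver-*ʳ k f []       = ≈-sym (zeroˡ k)
    sumOver-*ʳ k f (a ∷ xs) = ≈-trans (+-congˡ (sumOver-*ʳ k f xs)) (≈-sym (distribʳ k _ _))

    sumOver-+ : ∀ (f g : A → Carrier) xs → sumOver R (λ a → f a ⊕ g a) xs ≈ sumOver R f xs ⊕ sumOver R g xs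
    sumOver-+ f g []       = ≈-sym (+-identityˡ _)
    sumOver-+ f g (a ∷ xs) = ≈-trans (+-congˡ (sumOver-+ f g xs)) (⊕-interchange _ _ _ _)

    sumOver-foldr : ∀ (f : A → Carrier) xs → sumOver R f xs ≡ foldr _⊕_ 0# (map f xs)
    sumOver-foldr f []       = refl
    sumOver-foldr f (a ∷ xs) = cong (f a ⊕_) (sumOver-foldr f xs)

    sumOver-↭ : ∀ (f : A → Carrier) {xs ys} → xs ↭ ys → sumOver R f xs ≈ sumOver R f ys
    sumOver-↭ f {xs} {ys} xs↭ys = begin
      sumOver R f xs          ≡⟨ sumOver-foldr f xs ⟩
      foldr _⊕_ 0# (map f xs)
        ≈⟨ foldr-commMonoid setoid +-isCommutativeMonoid (↭⇒↭ₛ′ isEquivalence (map⁺ f xs↭ys)) ⟩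
      foldr _⊕_ 0# (map f ys) ≡⟨ sumOver-foldr f ys ⟨
      sumOver R f ys          ∎

    prodOver-cong : ∀ {f g : A → Carrier} xs → (∀ {a} → a ∈ xs → f a ≈ g a) → prodOver R f xs ≈ prodOver R g xs
    prodOver-cong []       f≈g = ≈-refl
    prodOver-cong (a ∷ xs) f≈g = *-cong (f≈g (here refl)) (prodOver-cong xs (f≈g ∘ there))

    prodOver-++ : ∀ (f : A → Carrier) xs ys → prodOver R f (xs ++ ys) ≈ prodOver R f xs * prodOver R f ys
    prodOver-++ f []       ys = ≈-sym (*-identityˡ _)
    prodOver-++ f (a ∷ xs) ys = ≈-trans (*-congˡ (prodOver-++ f xs ys)) (≈-sym (*-assoc _ _ _))

    prodOver-1 : ∀ (xs : List A) → prodOver R (λ _ → 1#) xs ≈ 1#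
    prodOver-1 []       = ≈-refl
    prodOver-1 (a ∷ xs) = ≈-trans (*-identityˡ _) (prodOver-1 xs)

  prodOver-upTo-suc : ∀ (f : ℕ → Carrier) k → prodOver R f (upTo (suc k)) ≈ prodOver R f (upTo k) * f k
  prodOver-upTo-suc f k = begin
    prodOver R f (upTo (suc k))         ≡⟨ cong (prodOver R f) (upTo-∷ʳ k) ⟨
    prodOver R f (upTo k ++ k ∷ [])     ≈⟨ prodOver-++ f (upTo k) (k ∷ []) ⟩
    prodOver R f (upTo k) * (f k * 1#)  ≈⟨ *-congˡ (*-identityʳ (f k)) ⟩
    prodOver R f (upTo k) * f k         ∎

  module _ {A B : Set} where

    sumOver-map : ∀ (f : B → Carrier) (g : A → B) xs → sumOver R f (map g xs) ≡ sumOver R (f ∘ g) xs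
    sumOver-map f g []       = refl
    sumOver-map f g (a ∷ xs) = cong (f (g a) ⊕_) (sumOver-map f g xs)

    sumOver-concatMap : ∀ (f : B → Carrier) (g : A → List B) xs →
                        sumOver R f (concatMap g xs) ≈ sumOver R (λ a → sumOver R f (g a)) xs
    sumOver-concatMap f g []       = ≈-refl
    sumOver-concatMap f g (a ∷ xs) = ≈-trans (sumOver-++ f (g a) (concatMap g xs)) (+-congˡ (sumOver-concatMap f g xs))

  times-+ : ∀ m n a → times R (m + n) a ≈ times R m a ⊕ times R n a
  times-+ zero    n a = ≈-sym (+-identityˡ _)
  times-+ (suc m) n a = ≈-trans (+-congˡ (times-+ m n a)) (≈-sym (+-assoc _ _ _))

  sumOver-times : ∀ {A : Set} (h : A → ℕ) u xs → sumOver R (λ a → times R (h a) u) xs ≈ times R (sum (map h xs)) u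
  sumOver-times h u []       = ≈-refl
  sumOver-times h u (a ∷ xs) = ≈-trans (+-congˡ (sumOver-times h u xs)) (≈-sym (times-+ (h a) _ u))

-- Grafting a leaf

leaf : ℕ → PTree
leaf l = node l []

occ : ℕ → PTree → ℕ
occ v T = count v (labels T)

occF : ℕ → List PTree → ℕ
occF v cs = count v (labelsF cs)

occF-∷ : ∀ v c cs → occF v (c ∷ cs) ≡ occ v c + occF v cs
occF-∷ v c cs = count-++ v (labels c) (labelsF cs)

occF-∷-≡0 : ∀ {v} c cs → occF v (c ∷ cs) ≡ 0 → occ v c ≡ 0 × occF v cs ≡ 0
occF-∷-≡0 {v} c cs eq = let eq′ = trans (sym (occF-∷ v c cs)) eq in ℕ.m+n≡0⇒m≡0 _ eq′ , ℕ.m+n≡0⇒n≡0 _ eq′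

occF-∷-≡1 : ∀ {v} c cs → occF v (c ∷ cs) ≡ 1 → (occ v c ≡ 1 × occF v cs ≡ 0) ⊎ (occ v c ≡ 0 × occF v cs ≡ 1)
occF-∷-≡1 {v} c cs eq = m+n≡1-cases _ (trans (sym (occF-∷ v c cs)) eq)

mutual
  childCount : ℕ → PTree → ℕ
  childCount v (node a cs) = (if a ≡ᵇ v then length cs else 0) + childCountF v cs

  childCountF : ℕ → List PTree → ℕ
  childCountF v []       = 0
  childCountF v (c ∷ cs) = childCount v c + childCountF v cs

mutual
  childCount-absent : ∀ {v} T → occ v T ≡ 0 → childCount v T ≡ 0
  childCount-absent {v} (node a cs) eq with a ≡ᵇ v
  ... | false = childCountF-absent cs eq

  childCountF-absent : ∀ {v} cs → occF v cs ≡ 0 → childCountF v cs ≡ 0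
  childCountF-absent []       eq = refl
  childCountF-absent (c ∷ cs) eq =
    let c∌v , cs∌v = occF-∷-≡0 c cs eq in cong₂ _+_ (childCount-absent c c∌v) (childCountF-absent cs cs∌v)

-- The new leaf l becomes child number j (counted from 0) of the vertex labelled p; a larger j appends it.
mutual
  graft : ℕ → ℕ → ℕ → PTree → PTree
  graft l p j (node a cs) = if a ≡ᵇ p then node a (insertAt j (leaf l) cs) else node a (graftF l p j cs)

  graftF : ℕ → ℕ → ℕ → List PTree → List PTree
  graftF l p j []       = []
  graftF l p j (c ∷ cs) = graft l p j c ∷ graftF l p j cs

mutual
  graft-absent : ∀ {l p j} T → occ p T ≡ 0 → graft l p j T ≡ T
  graft-absent {p = p} (node a cs) eq with a ≡ᵇ p
  ... | false = cong (node a) (graftF-absent cs eq)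

  graftF-absent : ∀ {l p j} cs → occF p cs ≡ 0 → graftF l p j cs ≡ cs
  graftF-absent []       eq = refl
  graftF-absent (c ∷ cs) eq =
    let c∌p , cs∌p = occF-∷-≡0 c cs eq in cong₂ _∷_ (graft-absent c c∌p) (graftF-absent cs cs∌p)

occF-insertAt : ∀ v j y cs → occF v (insertAt j y cs) ≡ occ v y + occF v cs
occF-insertAt v = insertAt-additive (occF v) (occ v) (occF-∷ v)

childCount-leaf : ∀ v l → childCount v (leaf l) ≡ 0
childCount-leaf v l with l ≡ᵇ v
... | true  = refl
... | false = refl

length-graftF : ∀ l p j cs → length (graftF l p j cs) ≡ length cs
length-graftF l p j []       = refl
length-graftF l p j (c ∷ cs) = cong suc (length-graftF l p j cs)

mutual
  occ-graft : ∀ {l p j} v T → occ p T ≡ 1 → occ v (graft l p j T) ≡ δ l v + occ v T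
  occ-graft {l} {p} {j} v (node a cs) p-once with a ≡ᵇ p | ≡ᵇ-reflects a p
  ... | true  | ofʸ refl = begin
    δ a v + occF v (insertAt j (leaf l) cs)  ≡⟨ cong (δ a v +_) (occF-insertAt v j (leaf l) cs) ⟩
    δ a v + ((δ l v + 0) + occF v cs)        ≡⟨ cong (λ n → δ a v + (n + occF v cs)) (ℕ.+-identityʳ (δ l v)) ⟩
    δ a v + (δ l v + occF v cs)              ≡⟨ x∙yz≈y∙xz (δ a v) (δ l v) (occF v cs) ⟩
    δ l v + (δ a v + occF v cs)              ∎
    where open ≡-Reasoning
  ... | false | _ = trans (cong (δ a v +_) (occF-graftF v cs p-once)) (x∙yz≈y∙xz (δ a v) (δ l v) (occF v cs))

  occF-graftF : ∀ {l p j} v cs → occF p cs ≡ 1 → occF v (graftF l p j cs) ≡ δ l v + occF v cs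
  occF-graftF {l} {p} {j} v (c ∷ cs) p-once
    rewrite occF-∷ v (graft l p j c) (graftF l p j cs) | occF-∷ v c cs with occF-∷-≡1 c cs p-once
  ... | inj₁ (c∋p , cs∌p) rewrite graftF-absent {l} {p} {j} cs cs∌p | occ-graft {l} {p} {j} v c c∋p =
    ℕ.+-assoc (δ l v) (occ v c) (occF v cs)
  ... | inj₂ (c∌p , cs∋p) rewrite graft-absent {l} {p} {j} c c∌p | occF-graftF {l} {p} {j} v cs cs∋p =
    x∙yz≈y∙xz (occ v c) (δ l v) (occF v cs)

mutual
  childCount-graft : ∀ {l p j} v T → occ p T ≡ 1 → childCount v (graft l p j T) ≡ δ p v + childCount v T
  childCount-graft {l} {p} {j} v (node a cs) p-once with a ≡ᵇ p | ≡ᵇ-reflects a p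
  ... | true  | ofʸ refl
    rewrite length-insertAt j (leaf l) cs
          | insertAt-additive (childCountF v) (childCount v) (λ _ _ → refl) j (leaf l) cs
          | childCount-leaf v l
    with a ≡ᵇ v
  ... | true  = refl
  ... | false = refl
  childCount-graft {l} {p} {j} v (node a cs) p-once | false | _
    rewrite length-graftF l p j cs | childCountF-graftF {l} {p} {j} v cs p-once =
    x∙yz≈y∙xz (if a ≡ᵇ v then length cs else 0) (δ p v) (childCountF v cs)

  childCountF-graftF : ∀ {l p j} v cs → occF p cs ≡ 1 → childCountF v (graftF l p j cs) ≡ δ p v + childCountF v cs
  childCountF-graftF {l} {p} {j} v (c ∷ cs) p-once with occF-∷-≡1 c cs p-once
  ... | inj₁ (c∋p , cs∌p) rewrite graftF-absent {l} {p} {j} cs cs∌p | childCount-graft {l} {p} {j} v c c∋p =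
    ℕ.+-assoc (δ p v) (childCount v c) (childCountF v cs)
  ... | inj₂ (c∌p , cs∋p) rewrite graft-absent {l} {p} {j} c c∌p | childCountF-graftF {l} {p} {j} v cs cs∋p =
    x∙yz≈y∙xz (childCount v c) (δ p v) (childCountF v cs)

∈-graft⁺ : ∀ {l p j v} T → occ p T ≡ 1 → v ∈ l ∷ labels T → v ∈ labels (graft l p j T)
∈-graft⁺ {v = v} T p-once = count-≡⇒∈ (sym (occ-graft v T p-once))

∈-graft⁻ : ∀ {l p j v} T → occ p T ≡ 1 → v ∈ labels (graft l p j T) → v ∈ l ∷ labels T
∈-graft⁻ {v = v} T p-once = count-≡⇒∈ (occ-graft v T p-once)

rootLabel∈labels : ∀ T → rootLabel T ∈ labels T
rootLabel∈labels (node a cs) = here refl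

rootLabel-graft : ∀ {l p j} T → rootLabel (graft l p j T) ≡ rootLabel T
rootLabel-graft {p = p} (node a cs) with a ≡ᵇ p
... | true  = refl
... | false = refl

rootLabel≢ : ∀ {l} T → occ l T ≡ 0 → (rootLabel T ≡ᵇ l) ≡ false
rootLabel≢ {l} T l∉T = ≢⇒≡ᵇ-false {rootLabel T} {l} (λ { refl → count≡0⇒∉ l∉T (rootLabel∈labels T) })

0<occ-graft : ∀ {l p j} T → occ p T ≡ 1 → 0 < occ p (graft l p j T)
0<occ-graft {l} {p} T p-once =
  subst (0 <_) (sym (occ-graft p T p-once)) (≤-trans (≤-reflexive (sym p-once)) (m≤n+m _ (δ l p)))

0<occF-graftF : ∀ {l p j} cs → occF p cs ≡ 1 → 0 < occF p (graftF l p j cs)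
0<occF-graftF {l} {p} cs p-once =
  subst (0 <_) (sym (occF-graftF p cs p-once)) (≤-trans (≤-reflexive (sym p-once)) (m≤n+m _ (δ l p)))

foldr-⊓-≤ : ∀ a {v} xs → v ∈ xs → foldr _⊓_ a xs ≤ v
foldr-⊓-≤ a (x ∷ xs) (here refl)  = ℕ.m⊓n≤m x _
foldr-⊓-≤ a (x ∷ xs) (there v∈xs) = ≤-trans (ℕ.m⊓n≤n x _) (foldr-⊓-≤ a xs v∈xs)

β≤ : ∀ T {v} → v ∈ labels T → β T ≤ v
β≤ T = foldr-⊓-≤ (rootLabel T) (labels T)

β∈ : ∀ T → β T ∈ labels T
β∈ (node a cs) with foldr-selective ℕ.⊓-sel a (a ∷ labelsF cs)
... | inj₁ β≡a  = subst (_∈ a ∷ labelsF cs) (sym β≡a) (here refl)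
... | inj₂ β∈cs = β∈cs

β-unique : ∀ T {m} → m ∈ labels T → (∀ {v} → v ∈ labels T → m ≤ v) → β T ≡ m
β-unique T m∈T m≤ = ℕ.≤-antisym (β≤ T m∈T) (m≤ (β∈ T))

β-leaf : ∀ l → β (leaf l) ≡ l
β-leaf l = ℕ.⊓-idem l

β-graft : ∀ {l p j} T → occ p T ≡ 1 → β (graft l p j T) ≡ β T ⊓ l
β-graft {l} T p-once = β-unique (graft _ _ _ T) m∈ m≤
  where
  m∈ : β T ⊓ l ∈ labels (graft _ _ _ T)
  m∈ with ℕ.⊓-sel (β T) l
  ... | inj₁ m≡β = ∈-graft⁺ T p-once (there (subst (_∈ labels T) (sym m≡β) (β∈ T)))
  ... | inj₂ m≡l = ∈-graft⁺ T p-once (here m≡l)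
  m≤ : ∀ {v} → v ∈ labels (graft _ _ _ T) → β T ⊓ l ≤ v
  m≤ v∈ with ∈-graft⁻ T p-once v∈
  ... | here refl  = ℕ.m⊓n≤n (β T) l
  ... | there v∈T = ≤-trans (ℕ.m⊓n≤m (β T) l) (β≤ T v∈T)

-- The subtrees of T that contain p are those rooted on the path from the root to p.
mutual
  OffPathBelow : ℕ → ℕ → PTree → Set
  OffPathBelow p l (node a cs) = OffPathBelowF p l cs

  OffPathBelowF : ℕ → ℕ → List PTree → Set
  OffPathBelowF p l []       = ⊤
  OffPathBelowF p l (c ∷ cs) = (occ p c ≡ 0 → β c < l) × OffPathBelow p l c × OffPathBelowF p l cs

offPathBelowF-absent : ∀ {p l} cs → OffPathBelowF p l cs → occF p cs ≡ 0 → All (λ c → β c < l) cs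
offPathBelowF-absent []       _                    _   = []
offPathBelowF-absent (c ∷ cs) (βc<l , _ , offcs) eq =
  let c∌p , cs∌p = occF-∷-≡0 c cs eq in βc<l c∌p ∷ offPathBelowF-absent cs offcs cs∌p

any-β-⊓ : ∀ {l} b cs → All (λ k → β k < l) cs → any (λ k → β k <ᵇ b ⊓ l) cs ≡ any (λ k → β k <ᵇ b) cs
any-β-⊓ b []       []               = refl
any-β-⊓ b (k ∷ cs) (βk<l ∷ βcs<l) =
  cong₂ _∨_ (<ᵇ-cong {β k} {b ⊓ _} {β k} {b} (<-⊓-below βk<l)) (any-β-⊓ b cs βcs<l)

any-β-graftF : ∀ {l p j} {b} cs → b < l → OffPathBelowF p l cs → occF p cs ≡ 1 →
               any (λ k → β k <ᵇ b) (graftF l p j cs) ≡ any (λ k → β k <ᵇ b) cs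
any-β-graftF {l} {p} {j} {b} (c ∷ cs) b<l (_ , _ , offcs) p-once with occF-∷-≡1 c cs p-once
... | inj₁ (c∋p , cs∌p) rewrite graftF-absent {l} {p} {j} cs cs∌p | β-graft {l} {p} {j} c c∋p =
  cong (_∨ any (λ k → β k <ᵇ b) cs) (<ᵇ-cong {β c ⊓ l} {b} {β c} {b} (⊓-<-below b<l))
... | inj₂ (c∌p , cs∋p) rewrite graft-absent {l} {p} {j} c c∌p =
  cong ((β c <ᵇ b) ∨_) (any-β-graftF cs b<l offcs cs∋p)

-- The subtree containing p has its minimum m replaced by m ⊓ l while all its siblings have minima below l,
-- so no comparison between siblings changes.
isElder-graft : ∀ {l p j} c cs → OffPathBelowF p l (c ∷ cs) → occF p (c ∷ cs) ≡ 1 →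
                isElder (graft l p j c) (graftF l p j cs) ≡ isElder c cs
isElder-graft {l} {p} {j} c cs (βc<l , _ , offcs) p-once with occF-∷-≡1 c cs p-once
... | inj₁ (c∋p , cs∌p) rewrite graftF-absent {l} {p} {j} cs cs∌p | β-graft {l} {p} {j} c c∋p =
  any-β-⊓ (β c) cs (offPathBelowF-absent cs offcs cs∌p)
... | inj₂ (c∌p , cs∋p) rewrite graft-absent {l} {p} {j} c c∌p = any-β-graftF cs (βc<l c∌p) offcs cs∋p

elderCount-graftF : ∀ {l p j} cs → OffPathBelowF p l cs → occF p cs ≡ 1 → elderCount (graftF l p j cs) ≡ elderCount cs
elderCount-graftF {l} {p} {j} (c ∷ cs) off p-once
  rewrite isElder-graft {l} {p} {j} c cs off p-once with occF-∷-≡1 c cs p-once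
... | inj₁ (_ , cs∌p) rewrite graftF-absent {l} {p} {j} cs cs∌p = refl
... | inj₂ (_ , cs∋p) rewrite elderCount-graftF {l} {p} {j} cs (proj₂ (proj₂ off)) cs∋p = refl

youngCount-graftF : ∀ {l p j} cs → OffPathBelowF p l cs → occF p cs ≡ 1 → youngCount (graftF l p j cs) ≡ youngCount cs
youngCount-graftF {l} {p} {j} (c ∷ cs) off p-once
  rewrite isElder-graft {l} {p} {j} c cs off p-once with occF-∷-≡1 c cs p-once
... | inj₁ (_ , cs∌p) rewrite graftF-absent {l} {p} {j} cs cs∌p = refl
... | inj₂ (_ , cs∋p) rewrite youngCount-graftF {l} {p} {j} cs (proj₂ (proj₂ off)) cs∋p = refl

isElder-insertLeaf : ∀ {l} c j cs → β c < l → isElder c (insertAt j (leaf l) cs) ≡ isElder c cs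
isElder-insertLeaf {l} c j cs βc<l = any-insertAt (λ k → β k <ᵇ β c) j cs l≮βc
  where
  l≮βc : (β (leaf l) <ᵇ β c) ≡ false
  l≮βc rewrite β-leaf l = ≮⇒<ᵇ-false (ℕ.<⇒≯ βc<l)

elderCount-insertLeaf : ∀ {l} j cs → All (λ c → β c < l) cs → j ≤ length cs →
                        elderCount (insertAt j (leaf l) cs) ≡ (if j ≡ᵇ length cs then 0 else 1) + elderCount cs
elderCount-insertLeaf         zero    []       _                _ = refl
elderCount-insertLeaf {l}     zero    (c ∷ cs) (βc<l ∷ _)       _ rewrite β-leaf l | <⇒<ᵇ-true βc<l = refl
elderCount-insertLeaf {l} (suc j) (c ∷ cs) (βc<l ∷ βcs<l) (s≤s j≤)
  rewrite isElder-insertLeaf c j cs βc<l | elderCount-insertLeaf j cs βcs<l j≤ =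
  x∙yz≈y∙xz (if isElder c cs then 1 else 0) (if j ≡ᵇ length cs then 0 else 1) (elderCount cs)

youngCount-insertLeaf : ∀ {l} j cs → All (λ c → β c < l) cs → j ≤ length cs →
                        youngCount (insertAt j (leaf l) cs) ≡ (if j ≡ᵇ length cs then 1 else 0) + youngCount cs
youngCount-insertLeaf         zero    []       _                _ = refl
youngCount-insertLeaf {l}     zero    (c ∷ cs) (βc<l ∷ _)       _ rewrite β-leaf l | <⇒<ᵇ-true βc<l = refl
youngCount-insertLeaf {l} (suc j) (c ∷ cs) (βc<l ∷ βcs<l) (s≤s j≤)
  rewrite isElder-insertLeaf c j cs βc<l | youngCount-insertLeaf j cs βcs<l j≤ =
  x∙yz≈y∙xz (if isElder c cs then 0 else 1) (if j ≡ᵇ length cs then 1 else 0) (youngCount cs)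

young-leaf : ∀ l i → young (leaf l) i ≡ 0
young-leaf l i with l ≡ᵇ i
... | true  = refl
... | false = refl

eld-insertLeaf : ∀ {l} a j cs → All (λ c → β c < l) cs → j ≤ length cs →
                 eld (node a (insertAt j (leaf l) cs)) ≡ (if j ≡ᵇ length cs then 0 else 1) + eld (node a cs)
eld-insertLeaf {l} a j cs βcs<l j≤
  rewrite elderCount-insertLeaf j cs βcs<l j≤ | insertAt-additive eldF eld (λ _ _ → refl) j (leaf l) cs =
  ℕ.+-assoc (if j ≡ᵇ length cs then 0 else 1) (elderCount cs) (eldF cs)

young-insertLeaf : ∀ {l} a j cs i → All (λ c → β c < l) cs → j ≤ length cs →
                   young (node a (insertAt j (leaf l) cs)) i ≡ (if j ≡ᵇ length cs then δ a i else 0) + young (node a cs) i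
young-insertLeaf {l} a j cs i βcs<l j≤
  rewrite youngCount-insertLeaf j cs βcs<l j≤
        | insertAt-additive (λ ds → youngF ds i) (λ c → young c i) (λ _ _ → refl) j (leaf l) cs
        | young-leaf l i
  with j ≡ᵇ length cs | a ≡ᵇ i
... | true  | true  = refl
... | true  | false = refl
... | false | true  = refl
... | false | false = refl

mutual
  eld-graft : ∀ {l p j} T → occ p T ≡ 1 → OffPathBelow p l T → j ≤ childCount p T →
              eld (graft l p j T) ≡ (if j ≡ᵇ childCount p T then 0 else 1) + eld T
  eld-graft {l} {p} {j} (node a cs) p-once off j≤ with a ≡ᵇ p | ≡ᵇ-reflects a p
  ... | true | ofʸ refl rewrite n≡0⇒m+n≡m (length cs) (childCountF-absent cs (ℕ.suc-injective p-once)) =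
    eld-insertLeaf a j cs (offPathBelowF-absent cs off (ℕ.suc-injective p-once)) j≤
  ... | false | _ rewrite elderCount-graftF {l} {p} {j} cs off p-once | eldF-graftF {l} {p} {j} cs p-once off j≤ =
    x∙yz≈y∙xz (elderCount cs) (if j ≡ᵇ childCountF p cs then 0 else 1) (eldF cs)

  eldF-graftF : ∀ {l p j} cs → occF p cs ≡ 1 → OffPathBelowF p l cs → j ≤ childCountF p cs →
                eldF (graftF l p j cs) ≡ (if j ≡ᵇ childCountF p cs then 0 else 1) + eldF cs
  eldF-graftF {l} {p} {j} (c ∷ cs) p-once (_ , offc , offcs) j≤ with occF-∷-≡1 c cs p-once
  ... | inj₁ (c∋p , cs∌p)
    rewrite graftF-absent {l} {p} {j} cs cs∌p | n≡0⇒m+n≡m (childCount p c) (childCountF-absent cs cs∌p)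
          | eld-graft {l} {p} {j} c c∋p offc j≤ =
    ℕ.+-assoc (if j ≡ᵇ childCount p c then 0 else 1) (eld c) (eldF cs)
  ... | inj₂ (c∌p , cs∋p)
    rewrite graft-absent {l} {p} {j} c c∌p | childCount-absent c c∌p
          | eldF-graftF {l} {p} {j} cs cs∋p offcs j≤ =
    x∙yz≈y∙xz (eld c) (if j ≡ᵇ childCountF p cs then 0 else 1) (eldF cs)

mutual
  young-graft : ∀ {l p j} T i → occ p T ≡ 1 → OffPathBelow p l T → j ≤ childCount p T →
                young (graft l p j T) i ≡ (if j ≡ᵇ childCount p T then δ p i else 0) + young T i
  young-graft {l} {p} {j} (node a cs) i p-once off j≤ with a ≡ᵇ p | ≡ᵇ-reflects a p
  ... | true | ofʸ refl rewrite n≡0⇒m+n≡m (length cs) (childCountF-absent cs (ℕ.suc-injective p-once)) =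
    young-insertLeaf a j cs i (offPathBelowF-absent cs off (ℕ.suc-injective p-once)) j≤
  ... | false | _ rewrite youngCount-graftF {l} {p} {j} cs off p-once | youngF-graftF {l} {p} {j} cs i p-once off j≤ =
    x∙yz≈y∙xz (if a ≡ᵇ i then youngCount cs else 0) (if j ≡ᵇ childCountF p cs then δ p i else 0) (youngF cs i)

  youngF-graftF : ∀ {l p j} cs i → occF p cs ≡ 1 → OffPathBelowF p l cs → j ≤ childCountF p cs →
                  youngF (graftF l p j cs) i ≡ (if j ≡ᵇ childCountF p cs then δ p i else 0) + youngF cs i
  youngF-graftF {l} {p} {j} (c ∷ cs) i p-once (_ , offc , offcs) j≤ with occF-∷-≡1 c cs p-once
  ... | inj₁ (c∋p , cs∌p)
    rewrite graftF-absent {l} {p} {j} cs cs∌p | n≡0⇒m+n≡m (childCount p c) (childCountF-absent cs cs∌p)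
          | young-graft {l} {p} {j} c i c∋p offc j≤ =
    ℕ.+-assoc (if j ≡ᵇ childCount p c then δ p i else 0) (young c i) (youngF cs i)
  ... | inj₂ (c∌p , cs∋p)
    rewrite graft-absent {l} {p} {j} c c∌p | childCount-absent c c∌p
          | youngF-graftF {l} {p} {j} cs i cs∋p offcs j≤ =
    x∙yz≈y∙xz (young c i) (if j ≡ᵇ childCountF p cs then δ p i else 0) (youngF cs i)

mutual
  leaves : PTree → List ℕ
  leaves (node a [])       = a ∷ []
  leaves (node a (c ∷ cs)) = leavesF (c ∷ cs)

  leavesF : List PTree → List ℕ
  leavesF []       = []
  leavesF (c ∷ cs) = leaves c ++ leavesF cs

mutual
  leaves⊆labels : ∀ T {v} → v ∈ leaves T → v ∈ labels T
  leaves⊆labels (node a [])       (here refl) = here refl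
  leaves⊆labels (node a (c ∷ cs)) v∈        = there (leavesF⊆labelsF (c ∷ cs) v∈)

  leavesF⊆labelsF : ∀ cs {v} → v ∈ leavesF cs → v ∈ labelsF cs
  leavesF⊆labelsF (c ∷ cs) v∈ with ∈-++⁻ (leaves c) v∈
  ... | inj₁ v∈c  = ∈-++⁺ˡ (leaves⊆labels c v∈c)
  ... | inj₂ v∈cs = ∈-++⁺ʳ (labels c) (leavesF⊆labelsF cs v∈cs)

some-leaf : ∀ T → ∃[ v ] v ∈ leaves T
some-leaf (node a [])       = a , here refl
some-leaf (node a (c ∷ cs)) = let v , v∈c = some-leaf c in v , ∈-++⁺ˡ v∈c

mutual
  leaves-below⇒offPathBelow : ∀ {p l} T → (∀ {v} → v ∈ leaves T → v ≢ p → v < l) → OffPathBelow p l T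
  leaves-below⇒offPathBelow (node a [])       below = tt
  leaves-below⇒offPathBelow (node a (c ∷ cs)) below = leavesF-below⇒offPathBelowF (c ∷ cs) below

  leavesF-below⇒offPathBelowF : ∀ {p l} cs → (∀ {v} → v ∈ leavesF cs → v ≢ p → v < l) → OffPathBelowF p l cs
  leavesF-below⇒offPathBelowF []       below = tt
  leavesF-below⇒offPathBelowF (c ∷ cs) below =
    βc<l , leaves-below⇒offPathBelow c (below ∘ ∈-++⁺ˡ)
         , leavesF-below⇒offPathBelowF cs (below ∘ ∈-++⁺ʳ (leaves c))
    where
    βc<l : _ → β c < _
    βc<l c∌p with some-leaf c
    ... | v , v∈c = ℕ.≤-<-trans (β≤ c (leaves⊆labels c v∈c))
                                (below (∈-++⁺ˡ v∈c) (λ { refl → count≡0⇒∉ c∌p (leaves⊆labels c v∈c) }))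

Distinct : PTree → Set
Distinct T = ∀ v → occ v T ≤ 1

DistinctF : List PTree → Set
DistinctF cs = ∀ v → occF v cs ≤ 1

distinct-children : ∀ a cs → Distinct (node a cs) → DistinctF cs
distinct-children a cs d v = ≤-trans (m≤n+m _ (δ a v)) (d v)

distinct-root : ∀ a cs → Distinct (node a cs) → occF a cs ≡ 0
distinct-root a cs d = m+n≤1⇒n≡0 (d a) (≤-reflexive (sym (δ-refl a)))

distinctF-∷ : ∀ c cs → DistinctF (c ∷ cs) → ∀ v → occ v c + occF v cs ≤ 1
distinctF-∷ c cs d v = subst (_≤ 1) (occF-∷ v c cs) (d v)

distinctF-head : ∀ c cs → DistinctF (c ∷ cs) → Distinct c
distinctF-head c cs d v = ≤-trans (m≤m+n _ _) (distinctF-∷ c cs d v)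

distinctF-tail : ∀ c cs → DistinctF (c ∷ cs) → DistinctF cs
distinctF-tail c cs d v = ≤-trans (m≤n+m _ _) (distinctF-∷ c cs d v)

mutual
  leaf⇒childCount≡0 : ∀ T {v} → Distinct T → v ∈ leaves T → childCount v T ≡ 0
  leaf⇒childCount≡0 (node a [])       {v} d (here refl) = childCount-leaf a a
  leaf⇒childCount≡0 (node a (c ∷ cs)) {v} d v∈ =
    trans (cong (λ b → (if b then length (c ∷ cs) else 0) + childCountF v (c ∷ cs)) (≢⇒≡ᵇ-false a≢v))
          (leafF⇒childCountF≡0 (c ∷ cs) (distinct-children a (c ∷ cs) d) v∈)
    where
    a≢v : a ≢ v
    a≢v refl = count≡0⇒∉ (distinct-root a (c ∷ cs) d) (leavesF⊆labelsF (c ∷ cs) v∈)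

  leafF⇒childCountF≡0 : ∀ cs {v} → DistinctF cs → v ∈ leavesF cs → childCountF v cs ≡ 0
  leafF⇒childCountF≡0 (c ∷ cs) {v} d v∈ with ∈-++⁻ (leaves c) v∈
  ... | inj₁ v∈c  =
    cong₂ _+_ (leaf⇒childCount≡0 c (distinctF-head c cs d) v∈c)
              (childCountF-absent cs (m+n≤1⇒n≡0 (distinctF-∷ c cs d v) (∈⇒0<count (leaves⊆labels c v∈c))))
  ... | inj₂ v∈cs =
    cong₂ _+_ (childCount-absent c (m+n≤1⇒m≡0 (distinctF-∷ c cs d v) (∈⇒0<count (leavesF⊆labelsF cs v∈cs))))
              (leafF⇒childCountF≡0 cs (distinctF-tail c cs d) v∈cs)

leafRoot⇒noChildren : ∀ a cs → childCount a (node a cs) ≡ 0 → cs ≡ []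
leafRoot⇒noChildren a cs eq =
  length≡0⇒[] cs (ℕ.m+n≡0⇒m≡0 (length cs)
    (subst (λ b → (if b then length cs else 0) + childCountF a cs ≡ 0) (≡ᵇ-refl a) eq))

leafRoot⇒single : ∀ T → childCount (rootLabel T) T ≡ 0 → length (labels T) ≡ 1
leafRoot⇒single (node a cs) eq rewrite leafRoot⇒noChildren a cs eq = refl

labelsF-empty : ∀ cs → length (labelsF cs) ≡ 0 → cs ≡ []
labelsF-empty []                _  = refl
labelsF-empty (node b ds ∷ cs) ()

mutual
  prune : ℕ → PTree → PTree
  prune l (node a cs) = node a (pruneF l cs)

  pruneF : ℕ → List PTree → List PTree
  pruneF l []       = []
  pruneF l (c ∷ cs) = if rootLabel c ≡ᵇ l then pruneF l cs else prune l c ∷ pruneF l cs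

mutual
  prune-absent : ∀ {l} T → occ l T ≡ 0 → prune l T ≡ T
  prune-absent (node a cs) l∉T = cong (node a) (pruneF-absent cs (ℕ.m+n≡0⇒n≡0 (δ a _) l∉T))

  pruneF-absent : ∀ {l} cs → occF l cs ≡ 0 → pruneF l cs ≡ cs
  pruneF-absent []       _     = refl
  pruneF-absent {l} (c ∷ cs) l∉ccs =
    let l∉c , l∉cs = occF-∷-≡0 c cs l∉ccs
    in trans (cong (λ b → if b then pruneF l cs else prune l c ∷ pruneF l cs) (rootLabel≢ c l∉c))
             (cong₂ _∷_ (prune-absent c l∉c) (pruneF-absent cs l∉cs))

pruneF-insertLeaf : ∀ {l} j cs → occF l cs ≡ 0 → pruneF l (insertAt j (leaf l) cs) ≡ cs
pruneF-insertLeaf {l} zero    cs       l∉cs rewrite ≡ᵇ-refl l = pruneF-absent cs l∉cs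
pruneF-insertLeaf {l} (suc j) []       l∉cs rewrite ≡ᵇ-refl l = refl
pruneF-insertLeaf {l} (suc j) (c ∷ cs) l∉ccs with occF-∷-≡0 c cs l∉ccs
... | l∉c , l∉cs rewrite rootLabel≢ c l∉c = cong₂ _∷_ (prune-absent c l∉c) (pruneF-insertLeaf j cs l∉cs)

mutual
  prune-graft : ∀ {l p j} T → occ l T ≡ 0 → occ p T ≡ 1 → prune l (graft l p j T) ≡ T
  prune-graft {l} {p} {j} (node a cs) l∉T p-once with a ≡ᵇ p
  ... | true  = cong (node a) (pruneF-insertLeaf j cs (ℕ.m+n≡0⇒n≡0 (δ a l) l∉T))
  ... | false = cong (node a) (pruneF-graftF cs (ℕ.m+n≡0⇒n≡0 (δ a l) l∉T) p-once)

  pruneF-graftF : ∀ {l p j} cs → occF l cs ≡ 0 → occF p cs ≡ 1 → pruneF l (graftF l p j cs) ≡ cs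
  pruneF-graftF {l} {p} {j} (c ∷ cs) l∉ccs p-once with occF-∷-≡0 c cs l∉ccs | occF-∷-≡1 c cs p-once
  ... | l∉c , l∉cs | inj₁ (c∋p , cs∌p)
    rewrite rootLabel-graft {l} {p} {j} c | rootLabel≢ c l∉c | graftF-absent {l} {p} {j} cs cs∌p =
    cong₂ _∷_ (prune-graft c l∉c c∋p) (pruneF-absent cs l∉cs)
  ... | l∉c , l∉cs | inj₂ (c∌p , cs∋p)
    rewrite rootLabel-graft {l} {p} {j} c | rootLabel≢ c l∉c | graft-absent {l} {p} {j} c c∌p =
    cong₂ _∷_ (prune-absent c l∉c) (pruneF-graftF cs l∉cs cs∋p)

∈-labelsF : ∀ {c v} cs → c ∈ cs → v ∈ labels c → v ∈ labelsF cs
∈-labelsF (c ∷ cs)  (here refl) v∈c = ∈-++⁺ˡ v∈c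
∈-labelsF (c′ ∷ cs) (there c∈)  v∈c = ∈-++⁺ʳ (labels c′) (∈-labelsF cs c∈ v∈c)

children : PTree → List PTree
children (node a cs) = cs

mutual
  graft-injectiveʲ : ∀ {l p j₁ j₂} T → occ l T ≡ 0 → occ p T ≡ 1 → j₁ ≤ childCount p T → j₂ ≤ childCount p T →
                     graft l p j₁ T ≡ graft l p j₂ T → j₁ ≡ j₂
  graft-injectiveʲ {l} {p} {j₁} {j₂} (node a cs) l∉T p-once b₁ b₂ eq with a ≡ᵇ p | ≡ᵇ-reflects a p
  ... | true  | ofʸ refl rewrite n≡0⇒m+n≡m (length cs) (childCountF-absent cs (ℕ.suc-injective p-once)) =
    insertAt-injective j₁ j₂ cs (λ l∈cs → count≡0⇒∉ (ℕ.m+n≡0⇒n≡0 (δ a l) l∉T) (∈-labelsF cs l∈cs (here refl)))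
                       b₁ b₂ (cong children eq)
  ... | false | _ = graftF-injectiveʲ cs (ℕ.m+n≡0⇒n≡0 (δ a l) l∉T) p-once b₁ b₂ (cong children eq)

  graftF-injectiveʲ : ∀ {l p j₁ j₂} cs → occF l cs ≡ 0 → occF p cs ≡ 1 →
                      j₁ ≤ childCountF p cs → j₂ ≤ childCountF p cs → graftF l p j₁ cs ≡ graftF l p j₂ cs → j₁ ≡ j₂
  graftF-injectiveʲ {l} {p} (c ∷ cs) l∉ccs p-once b₁ b₂ eq with occF-∷-≡1 c cs p-once
  ... | inj₁ (c∋p , cs∌p) rewrite n≡0⇒m+n≡m (childCount p c) (childCountF-absent cs cs∌p) =
    graft-injectiveʲ c (proj₁ (occF-∷-≡0 c cs l∉ccs)) c∋p b₁ b₂ (∷-injectiveˡ eq)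
  ... | inj₂ (c∌p , cs∋p) rewrite childCount-absent c c∌p =
    graftF-injectiveʲ cs (proj₂ (occF-∷-≡0 c cs l∉ccs)) cs∋p b₁ b₂ (∷-injectiveʳ eq)

graft-injective : ∀ {l p₁ p₂ j₁ j₂} T → occ l T ≡ 0 → occ p₁ T ≡ 1 → occ p₂ T ≡ 1 →
                  j₁ ≤ childCount p₁ T → j₂ ≤ childCount p₂ T → graft l p₁ j₁ T ≡ graft l p₂ j₂ T →
                  p₁ ≡ p₂ × j₁ ≡ j₂
graft-injective {l} {p₁} {p₂} {j₁} {j₂} T l∉T p₁-once p₂-once b₁ b₂ eq =
  p₁≡p₂ , graft-injectiveʲ T l∉T p₁-once b₁ (subst (λ q → j₂ ≤ childCount q T) (sym p₁≡p₂) b₂)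
                           (trans eq (cong (λ q → graft l q j₂ T) (sym p₁≡p₂)))
  where
  p₁≡p₂ : p₁ ≡ p₂
  p₁≡p₂ = δ-≗⇒≡ λ v → ℕ.+-cancelʳ-≡ _ _ _
    (trans (sym (childCount-graft v T p₁-once)) (trans (cong (childCount v) eq) (childCount-graft v T p₂-once)))

record Grafted (l : ℕ) (T : PTree) : Set where
  constructor grafted
  field
    parent position : ℕ
    base            : PTree
    parent-once     : occ parent base ≡ 1
    leaf-absent     : occ l base ≡ 0
    position≤       : position ≤ childCount parent base
    tree≡           : T ≡ graft l parent position base

data GraftedF (l : ℕ) (cs : List PTree) : Set where
  asChild : ∀ j ds → occF l ds ≡ 0 → j ≤ length ds → cs ≡ insertAt j (leaf l) ds → GraftedF l cs
  below   : ∀ p j ds → occF p ds ≡ 1 → occF l ds ≡ 0 → j ≤ childCountF p ds → cs ≡ graftF l p j ds → GraftedF l cs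

mutual
  split : ∀ {l} T → Distinct T → occ l T ≡ 1 → childCount l T ≡ 0 → rootLabel T ≢ l → Grafted l T
  split {l} (node a cs) d l-once l-leaf a≢l
    with splitF cs (distinct-children a cs d) (subst (λ n → n + occF l cs ≡ 1) (δ-≢ a≢l) l-once)
                   (subst (λ b → (if b then length cs else 0) + childCountF l cs ≡ 0) (≢⇒≡ᵇ-false a≢l) l-leaf)
  ... | asChild j ds l∉ds j≤ refl = grafted a j (node a ds) a-once (cong₂ _+_ (δ-≢ a≢l) l∉ds) j≤′ tree≡
    where
    a-once : occ a (node a ds) ≡ 1
    a-once = cong₂ _+_ (δ-refl a) (ℕ.m+n≡0⇒n≡0 (occ a (leaf l))
                                   (trans (sym (occF-insertAt a j (leaf l) ds)) (distinct-root a (insertAt j (leaf l) ds) d)))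
    j≤′ : j ≤ childCount a (node a ds)
    j≤′ rewrite ≡ᵇ-refl a = ≤-trans j≤ (m≤m+n _ _)
    tree≡ : node a (insertAt j (leaf l) ds) ≡ graft l a j (node a ds)
    tree≡ rewrite ≡ᵇ-refl a = refl
  ... | below p j ds p-once l∉ds j≤ refl =
    grafted p j (node a ds) (trans (cong (_+ occF p ds) (δ-≢ a≢p)) p-once) (cong₂ _+_ (δ-≢ a≢l) l∉ds) j≤′ tree≡
    where
    a≢p : a ≢ p
    a≢p refl = count≡0⇒∉ (distinct-root a (graftF l p j ds) d)
                         (0<count⇒∈ (labelsF (graftF l p j ds)) (0<occF-graftF ds p-once))
    j≤′ : j ≤ childCount p (node a ds)
    j≤′ rewrite ≢⇒≡ᵇ-false a≢p = j≤
    tree≡ : node a (graftF l p j ds) ≡ graft l p j (node a ds)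
    tree≡ rewrite ≢⇒≡ᵇ-false a≢p = refl

  splitF : ∀ {l} cs → DistinctF cs → occF l cs ≡ 1 → childCountF l cs ≡ 0 → GraftedF l cs
  splitF {l} (c ∷ cs) d l-once l-leaf with occF-∷-≡1 c cs l-once
  ... | inj₂ (l∉c , l∈cs) with splitF cs (distinctF-tail c cs d) l∈cs (ℕ.m+n≡0⇒n≡0 _ l-leaf)
  ...   | asChild j ds l∉ds j≤ refl = asChild (suc j) (c ∷ ds) (trans (occF-∷ l c ds) (cong₂ _+_ l∉c l∉ds)) (s≤s j≤) refl
  ...   | below p j ds p-once l∉ds j≤ refl =
    below p j (c ∷ ds) (trans (occF-∷ p c ds) (cong₂ _+_ p∉c p-once))
                       (trans (occF-∷ l c ds) (cong₂ _+_ l∉c l∉ds))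
          (≤-trans j≤ (m≤n+m _ _)) (cong (_∷ graftF l p j ds) (sym (graft-absent c p∉c)))
    where
    p∉c : occ p c ≡ 0
    p∉c = m+n≤1⇒m≡0 (distinctF-∷ c (graftF l p j ds) d p) (0<occF-graftF ds p-once)
  splitF {l} (c ∷ cs) d l-once l-leaf | inj₁ (l∈c , l∉cs) with rootLabel c ≡ᵇ l | ≡ᵇ-reflects (rootLabel c) l
  splitF {l} (node b ds ∷ cs) d l-once l-leaf | inj₁ (l∈c , l∉cs) | true | ofʸ refl =
    asChild 0 cs l∉cs z≤n (cong (λ es → node b es ∷ cs) (leafRoot⇒noChildren b ds (ℕ.m+n≡0⇒m≡0 _ l-leaf)))
  ... | false | ofⁿ root≢l with split c (distinctF-head c cs d) l∈c (ℕ.m+n≡0⇒m≡0 _ l-leaf) root≢l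
  ...   | grafted p j c′ p-once l∉c′ j≤ refl =
    below p j (c′ ∷ cs) (trans (occF-∷ p c′ cs) (cong₂ _+_ p-once p∉cs))
                        (trans (occF-∷ l c′ cs) (cong₂ _+_ l∉c′ l∉cs))
          (≤-trans j≤ (m≤m+n _ _)) (cong (graft l p j c′ ∷_) (sym (graftF-absent cs p∉cs)))
    where
    p∉cs : occF p cs ≡ 0
    p∉cs = m+n≤1⇒n≡0 (distinctF-∷ (graft l p j c′) cs d p) (0<occ-graft c′ p-once)

-- Codes

Code : Set
Code = List (ℕ × ℕ)

parents : Code → List ℕ
parents = map proj₁

Valid : List ℕ → Code → Set
Valid S []             = ⊤
Valid S ((p , j) ∷ cs) = p ∈ S × j ≤ count p (parents cs) × Valid S cs

parents⊆ : ∀ {S} code → Valid S code → ∀ {q} → q ∈ parents code → q ∈ S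
parents⊆ (_ ∷ cs) (p∈S , _ , _)     (here refl) = p∈S
parents⊆ (_ ∷ cs) (_ , _ , valid) (there q∈)  = parents⊆ cs valid q∈

Valid-⊆ : ∀ {S S′} code → (∀ {q} → q ∈ parents code → q ∈ S′) → Valid S code → Valid S′ code
Valid-⊆ []             _   _                 = tt
Valid-⊆ ((p , j) ∷ cs) ⊆S′ (_ , j≤ , valid) = ⊆S′ (here refl) , j≤ , Valid-⊆ cs (⊆S′ ∘ there) valid

nextLeaf : List ℕ → Code → ℕ
nextLeaf S code = largestZero (λ v → count v (parents code)) S

-- The head of a code is the last grafting step; the leaf it grafts is the largest label of S occurring
-- in no parent entry of the code, i.e. the largest leaf of the decoded tree.
decode : List ℕ → Code → PTree
decode S       ((p , j) ∷ cs) = let l = nextLeaf S ((p , j) ∷ cs) in graft l p j (decode (remove l S) cs)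
decode []      []             = leaf 0
decode (s ∷ _) []             = leaf s

module Removal {S : List ℕ} {l : ℕ} (uS : Unique S) (l∈S : l ∈ S) where

  S′ : List ℕ
  S′ = remove l S

  l-once : count l S ≡ 1
  l-once = ℕ.≤-antisym (Unique⇒count≤1 uS l) (∈⇒0<count l∈S)

  count-S′ : ∀ v → δ l v + count v S′ ≡ count v S
  count-S′ = count-remove S l-once

  count-S′-≢ : ∀ {v} → l ≢ v → count v S′ ≡ count v S
  count-S′-≢ {v} l≢v = trans (cong (_+ count v S′) (sym (δ-≢ l≢v))) (count-S′ v)

  l∉S′ : count l S′ ≡ 0
  l∉S′ = ℕ.suc-injective (trans (cong (_+ count l S′) (sym (δ-refl l))) (trans (count-S′ l) l-once))

  S′⊆S : ∀ {v} → v ∈ S′ → v ∈ S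
  S′⊆S {v} v∈S′ =
    0<count⇒∈ S (≤-trans (∈⇒0<count v∈S′) (≤-trans (m≤n+m _ (δ l v)) (≤-reflexive (count-S′ v))))

  S⊆S′ : ∀ {v} → l ≢ v → v ∈ S → v ∈ S′
  S⊆S′ l≢v = count-≡⇒∈ (sym (count-S′-≢ l≢v))

  S′-unique : Unique S′
  S′-unique = count≤1⇒Unique λ v →
    ≤-trans (m≤n+m _ (δ l v)) (≤-trans (≤-reflexive (count-S′ v)) (Unique⇒count≤1 uS v))

  length-S′ : length S ≡ suc (length S′)
  length-S′ = length-remove S l-once

module CodeStep {S : List ℕ} {p j : ℕ} {cs : Code} (uS : Unique S) (len : length S ≡ suc (length ((p , j) ∷ cs)))
                  (valid : Valid S ((p , j) ∷ cs)) where

  l : ℕ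
  l = nextLeaf S ((p , j) ∷ cs)

  l-spec : LargestZero (λ v → count v (parents ((p , j) ∷ cs))) S l
  l-spec with pigeonhole (parents ((p , j) ∷ cs)) uS (parents⊆ _ valid)
                (subst (_< length S) (sym (length-map proj₁ ((p , j) ∷ cs))) (≤-reflexive (sym len)))
  ... | v , v∈S , unused = largestZero-spec v∈S unused

  open LargestZero l-spec public
  open Removal uS member public

  p≢l : p ≢ l
  p≢l p≡l = contradiction (trans (cong (δ p) p≡l) (ℕ.m+n≡0⇒m≡0 (δ p l) vanishes))
                          (subst (_≢ 0) (sym (δ-refl p)) (λ ()))

  S′-length : length S′ ≡ suc (length cs)
  S′-length = ℕ.suc-injective (trans (sym length-S′) len)

  S′-valid : Valid S′ cs
  S′-valid = Valid-⊆ cs (λ q∈ → S⊆S′ (l≢q q∈) (parents⊆ cs (proj₂ (proj₂ valid)) q∈)) (proj₂ (proj₂ valid))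
    where
    l≢q : ∀ {q} → q ∈ parents cs → l ≢ q
    l≢q q∈ refl = count≡0⇒∉ (ℕ.m+n≡0⇒n≡0 (δ p l) vanishes) q∈

  p-once′ : count p S′ ≡ 1
  p-once′ = trans (count-S′-≢ (p≢l ∘ sym)) (ℕ.≤-antisym (Unique⇒count≤1 uS p) (∈⇒0<count (proj₁ valid)))

occ-decode : ∀ {S} code → Unique S → length S ≡ suc (length code) → Valid S code →
             ∀ v → occ v (decode S code) ≡ count v S
occ-decode {s ∷ []} [] _ _ _ v = refl
occ-decode {S} ((p , j) ∷ cs) uS len valid v = begin
  occ v (graft l p j (decode S′ cs))  ≡⟨ occ-graft v (decode S′ cs) (trans (IH p) p-once′) ⟩
  δ l v + occ v (decode S′ cs)        ≡⟨ cong (δ l v +_) (IH v) ⟩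
  δ l v + count v S′                  ≡⟨ count-S′ v ⟩
  count v S                           ∎
  where
  open ≡-Reasoning
  open CodeStep uS len valid
  IH = occ-decode cs S′-unique S′-length S′-valid

childCount-decode : ∀ {S} code → Unique S → length S ≡ suc (length code) → Valid S code →
                    ∀ v → childCount v (decode S code) ≡ count v (parents code)
childCount-decode {s ∷ []} [] _ _ _ v = childCount-leaf v s
childCount-decode {S} ((p , j) ∷ cs) uS len valid v =
  trans (childCount-graft v (decode S′ cs) (trans (occ-decode cs S′-unique S′-length S′-valid p) p-once′))
        (cong (δ p v +_) (childCount-decode cs S′-unique S′-length S′-valid v))
  where open CodeStep uS len valid

decode-distinct : ∀ {S} code → Unique S → length S ≡ suc (length code) → Valid S code → Distinct (decode S code)
decode-distinct code uS len valid v = subst (_≤ 1) (sym (occ-decode code uS len valid v)) (Unique⇒count≤1 uS v)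

module DecodeStep {S : List ℕ} {p j : ℕ} {cs : Code} (uS : Unique S) (len : length S ≡ suc (length ((p , j) ∷ cs)))
                   (valid : Valid S ((p , j) ∷ cs)) where
  open CodeStep uS len valid public

  T′ : PTree
  T′ = decode S′ cs

  occ-T′ : ∀ v → occ v T′ ≡ count v S′
  occ-T′ = occ-decode cs S′-unique S′-length S′-valid

  childCount-T′ : ∀ v → childCount v T′ ≡ count v (parents cs)
  childCount-T′ = childCount-decode cs S′-unique S′-length S′-valid

  l∉T′ : occ l T′ ≡ 0
  l∉T′ = trans (occ-T′ l) l∉S′

  p-once-T′ : occ p T′ ≡ 1
  p-once-T′ = trans (occ-T′ p) p-once′

  j≤childCount : j ≤ childCount p T′
  j≤childCount = subst (j ≤_) (sym (childCount-T′ p)) (proj₁ (proj₂ valid))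

  prune-decode : prune l (decode S ((p , j) ∷ cs)) ≡ T′
  prune-decode = prune-graft T′ l∉T′ p-once-T′

  leaves<l : ∀ {v} → v ∈ leaves T′ → v ≢ p → v < l
  leaves<l {v} v∈ v≢p = ℕ.≤∧≢⇒< (largest (S′⊆S v∈S′) unused) (λ { refl → count≡0⇒∉ l∉S′ v∈S′ })
    where
    v∈S′ : v ∈ S′
    v∈S′ = 0<count⇒∈ S′ (subst (0 <_) (occ-T′ v) (∈⇒0<count (leaves⊆labels T′ v∈)))
    unused : δ p v + count v (parents cs) ≡ 0
    unused = cong₂ _+_ (δ-≢ (v≢p ∘ sym))
                       (trans (sym (childCount-T′ v))
                              (leaf⇒childCount≡0 T′ (decode-distinct cs S′-unique S′-length S′-valid) v∈))

decode-injective : ∀ {S} c₁ c₂ → Unique S → length S ≡ suc (length c₁) → length S ≡ suc (length c₂) →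
                   Valid S c₁ → Valid S c₂ → decode S c₁ ≡ decode S c₂ → c₁ ≡ c₂
decode-injective []      []      _ _    _    _ _ _ = refl
decode-injective []      (_ ∷ _) _ len₁ len₂ _ _ _ = contradiction (trans (sym len₁) len₂) (λ ())
decode-injective (_ ∷ _) []      _ len₁ len₂ _ _ _ = contradiction (trans (sym len₁) len₂) (λ ())
decode-injective {S} ((p₁ , j₁) ∷ cs₁) ((p₂ , j₂) ∷ cs₂) uS len₁ len₂ valid₁ valid₂ eq =
  cong₂ _∷_ (cong₂ _,_ (proj₁ p,j≡) (proj₂ p,j≡)) cs₁≡cs₂
  where
  module A = DecodeStep uS len₁ valid₁
  module B = DecodeStep uS len₂ valid₂
  l₁≡l₂ : A.l ≡ B.l
  l₁≡l₂ = largestZero-cong S λ v →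
    trans (sym (childCount-decode _ uS len₁ valid₁ v))
          (trans (cong (childCount v) eq) (childCount-decode _ uS len₂ valid₂ v))
  T′₁≡T′₂ : A.T′ ≡ B.T′
  T′₁≡T′₂ = trans (sym A.prune-decode) (trans (cong₂ prune l₁≡l₂ eq) B.prune-decode)
  S′₁≡S′₂ : A.S′ ≡ B.S′
  S′₁≡S′₂ = cong (λ m → remove m S) l₁≡l₂
  cs₁≡cs₂ : cs₁ ≡ cs₂
  cs₁≡cs₂ = decode-injective cs₁ cs₂ A.S′-unique A.S′-length (trans (cong length S′₁≡S′₂) B.S′-length)
              A.S′-valid (subst (λ S′ → Valid S′ cs₂) (sym S′₁≡S′₂) B.S′-valid)
              (trans T′₁≡T′₂ (cong (λ S′ → decode S′ cs₂) (sym S′₁≡S′₂)))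
  p,j≡ : p₁ ≡ p₂ × j₁ ≡ j₂
  p,j≡ = graft-injective A.T′ A.l∉T′ A.p-once-T′ (subst (λ T → occ p₂ T ≡ 1) (sym T′₁≡T′₂) B.p-once-T′)
           A.j≤childCount (subst (λ T → j₂ ≤ childCount p₂ T) (sym T′₁≡T′₂) B.j≤childCount)
           (trans eq (cong₂ (λ m T → graft m p₂ j₂ T) (sym l₁≡l₂) (sym T′₁≡T′₂)))

decode-single : ∀ {s} T → (∀ v → occ v T ≡ count v (s ∷ [])) → decode (s ∷ []) [] ≡ T
decode-single {s} (node a cs) T-on-s = cong₂ node s≡a (sym cs≡[])
  where
  labels↭ : a ∷ labelsF cs ↭ s ∷ []
  labels↭ = count-≗⇒↭ T-on-s ([] ∷ [])
  cs≡[] : cs ≡ []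
  cs≡[] = labelsF-empty cs (ℕ.suc-injective (↭-length labels↭))
  s≡a : s ≡ a
  s≡a with ∈-resp-↭ labels↭ (here refl)
  ... | here a≡s = sym a≡s

largestLeaf-grafted : ∀ {S k} T → Unique S → length S ≡ suc (suc k) → (∀ v → occ v T ≡ count v S) →
                      let l = largestZero (λ v → childCount v T) S in l ∈ S × Grafted l T
largestLeaf-grafted {S} T uS len T-on-S = member , split T distinct (trans (T-on-S l) l-once) vanishes root≢l
  where
  distinct : Distinct T
  distinct v = subst (_≤ 1) (sym (T-on-S v)) (Unique⇒count≤1 uS v)
  labels↭ : labels T ↭ S
  labels↭ = count-≗⇒↭ T-on-S uS
  l = largestZero (λ v → childCount v T) S
  spec : LargestZero (λ v → childCount v T) S l
  spec = let v , v∈ = some-leaf T in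
    largestZero-spec (∈-resp-↭ labels↭ (leaves⊆labels T v∈)) (leaf⇒childCount≡0 T distinct v∈)
  open LargestZero spec
  open Removal uS member
  root≢l : rootLabel T ≢ l
  root≢l root≡l = contradiction
    (trans (sym (leafRoot⇒single T (subst (λ r → childCount r T ≡ 0) (sym root≡l) vanishes)))
           (trans (↭-length labels↭) len))
    (λ ())

grafted-base : ∀ {S l T} → Unique S → l ∈ S → (∀ v → occ v T ≡ count v S) → (g : Grafted l T) →
               ∀ v → occ v (Grafted.base g) ≡ count v (remove l S)
grafted-base {S} {l} {T} uS l∈S T-on-S (grafted p j T′ p-once _ _ refl) v =
  ℕ.+-cancelˡ-≡ (δ l v) _ _ (trans (sym (occ-graft v T′ p-once)) (trans (T-on-S v) (sym (count-S′ v))))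
  where open Removal uS l∈S

decode-surjective : ∀ {S} k T → Unique S → length S ≡ suc k → (∀ v → occ v T ≡ count v S) →
                    ∃[ code ] Valid S code × length code ≡ k × decode S code ≡ T
decode-surjective {s ∷ []} zero T uS refl T-on-S = [] , tt , refl , decode-single T T-on-S
decode-surjective {S} (suc k) T uS len T-on-S =
  (p , j) ∷ code′ , (p∈S , j≤ , Valid-⊆ code′ (S′⊆S ∘ parents⊆ code′ valid′) valid′) , cong suc len′ , decode≡
  where
  l = largestZero (λ v → childCount v T) S
  l∈S = proj₁ (largestLeaf-grafted T uS len T-on-S)
  g = proj₂ (largestLeaf-grafted T uS len T-on-S)
  open Removal uS l∈S
  open Grafted g renaming (parent to p; position to j; base to T′)
  T′-on-S′ = grafted-base uS l∈S T-on-S g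
  S′-length = ℕ.suc-injective (trans (sym length-S′) len)
  IH = decode-surjective k T′ S′-unique S′-length T′-on-S′
  code′ = proj₁ IH
  valid′ = proj₁ (proj₂ IH)
  len′ = proj₁ (proj₂ (proj₂ IH))
  decode≡T′ = proj₂ (proj₂ (proj₂ IH))
  childCount-T′ : ∀ v → childCount v T′ ≡ count v (parents code′)
  childCount-T′ v = trans (cong (childCount v) (sym decode≡T′))
                          (childCount-decode code′ S′-unique (trans S′-length (cong suc (sym len′))) valid′ v)
  p∈S : p ∈ S
  p∈S = S′⊆S (0<count⇒∈ S′ (subst (0 <_) (T′-on-S′ p) (≤-reflexive (sym parent-once))))
  j≤ : j ≤ count p (parents code′)
  j≤ = subst (j ≤_) (childCount-T′ p) position≤
  next≡l : nextLeaf S ((p , j) ∷ code′) ≡ l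
  next≡l = largestZero-cong S λ v → begin
    δ p v + count v (parents code′) ≡⟨ cong (δ p v +_) (childCount-T′ v) ⟨
    δ p v + childCount v T′         ≡⟨ childCount-graft v T′ parent-once ⟨
    childCount v (graft l p j T′)   ≡⟨ cong (childCount v) tree≡ ⟨
    childCount v T                  ∎
    where open ≡-Reasoning
  decode≡ : decode S ((p , j) ∷ code′) ≡ T
  decode≡ = begin
    decode S ((p , j) ∷ code′)    ≡⟨ cong (λ m → graft m p j (decode (remove m S) code′)) next≡l ⟩
    graft l p j (decode S′ code′) ≡⟨ cong (graft l p j) decode≡T′ ⟩
    graft l p j T′                ≡⟨ tree≡ ⟨
    T                             ∎
    where open ≡-Reasoning

extensions : List ℕ → Code → List Code
extensions S cs = concatMap (λ p → map (λ j → (p , j) ∷ cs) (downFrom (suc (count p (parents cs))))) S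

codes : List ℕ → ℕ → List Code
codes S zero    = [] ∷ []
codes S (suc k) = concatMap (extensions S) (codes S k)

∈-extensions⁻ : ∀ {S cs c} → c ∈ extensions S cs →
                ∃[ p ] ∃[ j ] c ≡ (p , j) ∷ cs × p ∈ S × j ≤ count p (parents cs)
∈-extensions⁻ {S} c∈ with ∈-concatMap {xs = S} c∈
... | p , p∈S , c∈p with ∈-map⁻ (λ j → (p , _) ∷ _) c∈p
...   | j , j∈ , refl = p , j , refl , p∈S , ℕ.≤-pred (∈-downFrom⁻ j∈)

∈-extensions⁺ : ∀ {S cs p j} → p ∈ S → j ≤ count p (parents cs) → (p , j) ∷ cs ∈ extensions S cs
∈-extensions⁺ p∈S j≤ = ∈-concatMap⁺ _ (lose p∈S (∈-map⁺ _ (∈-downFrom⁺ (s≤s j≤))))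

∈-codes⁻ : ∀ {S} k {c} → c ∈ codes S k → Valid S c × length c ≡ k
∈-codes⁻ zero    (here refl) = tt , refl
∈-codes⁻ {S} (suc k) c∈ with ∈-concatMap {xs = codes S k} c∈
... | cs , cs∈ , c∈ext with ∈-extensions⁻ {S} {cs} c∈ext | ∈-codes⁻ k cs∈
...   | p , j , refl , p∈S , j≤ | valid , refl = (p∈S , j≤ , valid) , refl

∈-codes⁺ : ∀ {S} c → Valid S c → c ∈ codes S (length c)
∈-codes⁺ []             _                  = here refl
∈-codes⁺ ((p , j) ∷ cs) (p∈S , j≤ , valid) = ∈-concatMap⁺ _ (lose (∈-codes⁺ cs valid) (∈-extensions⁺ p∈S j≤))

firstParent : Code → ℕ
firstParent []             = 0
firstParent ((p , _) ∷ _) = p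

extensions-unique : ∀ {S} cs → Unique S → Unique (extensions S cs)
extensions-unique {S} cs uS =
  concatMap-unique firstParent first uS (λ p → Unique.map⁺ (cong proj₂ ∘ ∷-injectiveˡ) (downFrom⁺ _))
  where
  first : ∀ {p c} → c ∈ map (λ j → (p , j) ∷ cs) (downFrom (suc (count p (parents cs)))) → firstParent c ≡ p
  first c∈ with ∈-map⁻ _ c∈
  ... | _ , _ , refl = refl

codes-unique : ∀ {S} k → Unique S → Unique (codes S k)
codes-unique zero    uS = [] ∷ []
codes-unique {S} (suc k) uS = concatMap-unique (drop 1) rest (codes-unique k uS) (λ cs → extensions-unique cs uS)
  where
  rest : ∀ {cs c} → c ∈ extensions S cs → drop 1 c ≡ cs
  rest {cs} c∈ with ∈-extensions⁻ {S} {cs} c∈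
  ... | _ , _ , refl , _ = refl

module Enumeration {S : List ℕ} {k : ℕ} (uS : Unique S) (len : length S ≡ suc k) where

  length-code : ∀ {c} → c ∈ codes S k → length S ≡ suc (length c)
  length-code c∈ = trans len (cong suc (sym (proj₂ (∈-codes⁻ k c∈))))

  decoded-unique : Unique (map (decode S) (codes S k))
  decoded-unique = map-unique (decode S)
    (λ c₁∈ c₂∈ → decode-injective _ _ uS (length-code c₁∈) (length-code c₂∈)
                                        (proj₁ (∈-codes⁻ k c₁∈)) (proj₁ (∈-codes⁻ k c₂∈)))
    (codes-unique k uS)

  ∈-decoded⇔ : ∀ {T} → T ∈ map (decode S) (codes S k) ⇔ (labels T ↭ S)
  ∈-decoded⇔ {T} = mk⇔ to from
    where
    to : T ∈ map (decode S) (codes S k) → labels T ↭ S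
    to T∈ with ∈-map⁻ (decode S) T∈
    ... | c , c∈ , refl = count-≗⇒↭ (occ-decode c uS (length-code c∈) (proj₁ (∈-codes⁻ k c∈))) uS
    from : labels T ↭ S → T ∈ map (decode S) (codes S k)
    from labels↭ with decode-surjective k T uS len (λ v → count-↭ v labels↭)
    ... | c , valid , refl , refl = ∈-map⁺ (decode S) (∈-codes⁺ c valid)

  enumeration : ∀ {Ps} → Unique Ps → (∀ T → T ∈ Ps ⇔ (labels T ↭ S)) → Ps ↭ map (decode S) (codes S k)
  enumeration uPs Ps⇔ = ∼bag⇒↭ (unique∧set⇒bag uPs decoded-unique
    (λ {T} → mk⇔ (Equivalence.from ∈-decoded⇔ ∘ Equivalence.to (Ps⇔ T))
                 (Equivalence.from (Ps⇔ T) ∘ Equivalence.to ∈-decoded⇔)))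

-- Weights

module Weights {c ℓ} (R : CommutativeSemiring c ℓ)
               (x : ℕ → CommutativeSemiring.Carrier R) (t : CommutativeSemiring.Carrier R) where
  open CommutativeSemiring R renaming (_+_ to _⊕_; refl to ≈-refl; sym to ≈-sym; trans to ≈-trans)
  open import Relation.Binary.Reasoning.Setoid setoid
  open CommSemigroupProperties *-commutativeSemigroup using () renaming (x∙yz≈y∙xz to x*yz≈y*xz)
  open Sums R

  weight : List ℕ → PTree → Carrier
  weight A T = pow R t (eld T) * prodOver R (λ i → pow R (x i) (young T i)) A

  stepWeight : ℕ → ℕ → ℕ → Carrier
  stepWeight p j d = if j ≡ᵇ d then x p else t

  prodOver-bump : ∀ {p} A (f : ℕ → ℕ) → count p A ≡ 1 →
                  prodOver R (λ i → pow R (x i) (δ p i + f i)) A ≈ x p * prodOver R (λ i → pow R (x i) (f i)) A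
  prodOver-bump {p} (a ∷ A) f once with p ≡ᵇ a | ≡ᵇ-reflects p a
  ... | true  | ofʸ refl = begin
    (x p * pow R (x p) (f p)) * prodOver R (λ i → pow R (x i) (δ p i + f i)) A
      ≈⟨ *-congˡ (prodOver-cong A (λ {i} i∈A → reflexive (cong (λ n → pow R (x i) (n + f i)) (δ-≢ (p≢ i∈A))))) ⟩
    (x p * pow R (x p) (f p)) * prodOver R (λ i → pow R (x i) (f i)) A
      ≈⟨ *-assoc (x p) _ _ ⟩
    x p * (pow R (x p) (f p) * prodOver R (λ i → pow R (x i) (f i)) A) ∎
    where
    p≢ : ∀ {i} → i ∈ A → p ≢ i
    p≢ i∈A refl = count≡0⇒∉ (ℕ.suc-injective (trans (cong (_+ count p A) (sym (δ-refl p))) once)) i∈A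
  ... | false | ofⁿ p≢a = begin
    pow R (x a) (f a) * prodOver R (λ i → pow R (x i) (δ p i + f i)) A
      ≈⟨ *-congˡ (prodOver-bump A f (trans (cong (_+ count p A) (sym (δ-≢ (p≢a ∘ sym)))) once)) ⟩
    pow R (x a) (f a) * (x p * prodOver R (λ i → pow R (x i) (f i)) A)
      ≈⟨ x*yz≈y*xz _ _ _ ⟩
    x p * (pow R (x a) (f a) * prodOver R (λ i → pow R (x i) (f i)) A) ∎

  weight-bump : ∀ b {p} A e (f : ℕ → ℕ) → count p A ≡ 1 →
                pow R t ((if b then 0 else 1) + e) * prodOver R (λ i → pow R (x i) ((if b then δ p i else 0) + f i)) A
                  ≈ (if b then x p else t) * (pow R t e * prodOver R (λ i → pow R (x i) (f i)) A)
  weight-bump true  A e f once = ≈-trans (*-congˡ (prodOver-bump A f once)) (x*yz≈y*xz _ _ _)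
  weight-bump false A e f once = *-assoc t _ _

  weight-graft : ∀ {l p j} A T → count p A ≡ 1 → occ p T ≡ 1 → OffPathBelow p l T → j ≤ childCount p T →
                 weight A (graft l p j T) ≈ stepWeight p j (childCount p T) * weight A T
  weight-graft {l} {p} {j} A T p-once-A p-once off j≤ = begin
    weight A (graft l p j T)
      ≈⟨ *-cong (reflexive (cong (pow R t) (eld-graft T p-once off j≤)))
                (prodOver-cong A (λ {i} _ → reflexive (cong (pow R (x i)) (young-graft T i p-once off j≤)))) ⟩
    pow R t ((if j ≡ᵇ d then 0 else 1) + eld T)
      * prodOver R (λ i → pow R (x i) ((if j ≡ᵇ d then δ p i else 0) + young T i)) A
      ≈⟨ weight-bump (j ≡ᵇ d) A (eld T) (young T) p-once-A ⟩
    stepWeight p j d * weight A T ∎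
    where
    d = childCount p T

  weight-leaf : ∀ A s → weight A (leaf s) ≈ 1#
  weight-leaf A s = ≈-trans (*-identityˡ _)
    (≈-trans (prodOver-cong A (λ {i} _ → reflexive (cong (pow R (x i)) (young-leaf s i)))) (prodOver-1 A))

  codeWeight : Code → Carrier
  codeWeight []             = 1#
  codeWeight ((p , j) ∷ cs) = stepWeight p j (count p (parents cs)) * codeWeight cs

  weight-decode : ∀ {A S} code → Unique A → (∀ {v} → v ∈ S → v ∈ A) → Unique S → length S ≡ suc (length code) →
                  Valid S code → weight A (decode S code) ≈ codeWeight code
  weight-decode {A} {s ∷ []} [] _ _ _ _ _ = weight-leaf A s
  weight-decode {A} {S} ((p , j) ∷ cs) uA S⊆A uS len valid = begin
    weight A (graft l p j T′)
      ≈⟨ weight-graft A T′ p-once-A p-once-T′ (leaves-below⇒offPathBelow T′ leaves<l) j≤childCount ⟩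
    stepWeight p j (childCount p T′) * weight A T′
      ≈⟨ *-cong (reflexive (cong (stepWeight p j) (childCount-T′ p)))
                (weight-decode cs uA (S⊆A ∘ S′⊆S) S′-unique S′-length S′-valid) ⟩
    stepWeight p j (count p (parents cs)) * codeWeight cs ∎
    where
    open DecodeStep uS len valid
    p-once-A : count p A ≡ 1
    p-once-A = ℕ.≤-antisym (Unique⇒count≤1 uA p) (∈⇒0<count (S⊆A (proj₁ valid)))

  earlier-positions-sum : ∀ p m d → m ≤ d → sumOver R (λ j → stepWeight p j d) (downFrom m) ≈ times R m t
  earlier-positions-sum p zero    d _   = ≈-refl
  earlier-positions-sum p (suc m) d m<d rewrite ≢⇒≡ᵇ-false (ℕ.<⇒≢ m<d) = +-congˡ (earlier-positions-sum p m d (ℕ.<⇒≤ m<d))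

  positions-sum : ∀ p d → sumOver R (λ j → stepWeight p j d) (downFrom (suc d)) ≈ x p ⊕ times R d t
  positions-sum p d rewrite ≡ᵇ-refl d = +-congˡ (earlier-positions-sum p d d ℕ.≤-refl)

  extensions-sum : ∀ {S} cs → Unique S → (∀ {q} → q ∈ parents cs → q ∈ S) →
                   sumOver R codeWeight (extensions S cs) ≈ (sumOver R x S ⊕ times R (length cs) t) * codeWeight cs
  extensions-sum {S} cs uS parents⊆S = begin
    sumOver R codeWeight (extensions S cs)
      ≈⟨ sumOver-concatMap codeWeight (λ p → map (λ j → (p , j) ∷ cs) (downFrom (suc (d p)))) S ⟩
    sumOver R (λ p → sumOver R codeWeight (map (λ j → (p , j) ∷ cs) (downFrom (suc (d p))))) S
      ≈⟨ sumOver-cong S (λ {p} _ → ≈-trans (reflexive (sumOver-map codeWeight _ (downFrom (suc (d p)))))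
                                   (≈-trans (sumOver-*ʳ (codeWeight cs) _ (downFrom (suc (d p))))
                                            (*-congʳ (positions-sum p (d p))))) ⟩
    sumOver R (λ p → (x p ⊕ times R (d p) t) * codeWeight cs) S
      ≈⟨ sumOver-*ʳ (codeWeight cs) _ S ⟩
    sumOver R (λ p → x p ⊕ times R (d p) t) S * codeWeight cs
      ≈⟨ *-congʳ (≈-trans (sumOver-+ x _ S) (+-congˡ (sumOver-times d t S))) ⟩
    (sumOver R x S ⊕ times R (sum (map d S)) t) * codeWeight cs
      ≡⟨ cong (λ n → (sumOver R x S ⊕ times R n t) * codeWeight cs)
              (trans (sum-count (parents cs) uS parents⊆S) (length-map proj₁ cs)) ⟩
    (sumOver R x S ⊕ times R (length cs) t) * codeWeight cs ∎
    where
    d : ℕ → ℕ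
    d p = count p (parents cs)

  codes-sum : ∀ {S} k → Unique S →
              sumOver R codeWeight (codes S k) ≈ prodOver R (λ i → sumOver R x S ⊕ times R i t) (upTo k)
  codes-sum         zero    uS = +-identityʳ 1#
  codes-sum {S} (suc k) uS = begin
    sumOver R codeWeight (concatMap (extensions S) (codes S k))
      ≈⟨ sumOver-concatMap codeWeight (extensions S) (codes S k) ⟩
    sumOver R (λ cs → sumOver R codeWeight (extensions S cs)) (codes S k)
      ≈⟨ sumOver-cong (codes S k) (λ {cs} cs∈ →
           ≈-trans (extensions-sum cs uS (parents⊆ cs (proj₁ (∈-codes⁻ k cs∈))))
                   (reflexive (cong (λ n → F n * codeWeight cs) (proj₂ (∈-codes⁻ k cs∈))))) ⟩
    sumOver R (λ cs → F k * codeWeight cs) (codes S k)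
      ≈⟨ sumOver-*ˡ (F k) codeWeight (codes S k) ⟩
    F k * sumOver R codeWeight (codes S k)
      ≈⟨ *-congˡ (codes-sum k uS) ⟩
    F k * prodOver R F (upTo k)
      ≈⟨ *-comm _ _ ⟩
    prodOver R F (upTo k) * F k
      ≈⟨ prodOver-upTo-suc F k ⟨
    prodOver R F (upTo (suc k)) ∎
    where
    F : ℕ → Carrier
    F i = sumOver R x S ⊕ times R i t

theorem4p3 : ∀ {c ℓ} (R : CommutativeSemiring c ℓ) (n : ℕ) → 1 ≤ n →
    (Ps : List PTree) → Unique Ps → (∀ T → (T ∈ Ps) ⇔ IsPlaneTreeOn n T) →
    (x : ℕ → CommutativeSemiring.Carrier R) (t : CommutativeSemiring.Carrier R) →
    CommutativeSemiring._≈_ R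
      (sumOver R (λ T → CommutativeSemiring._*_ R (pow R t (eld T))
                          (prodOver R (λ i → pow R (x i) (young T i)) (map suc (upTo n)))) Ps)
      (prodOver R (λ k → CommutativeSemiring._+_ R (sumOver R x (map suc (upTo n))) (times R k t))
                  (upTo (n ∸ 1)))
theorem4p3 R (suc k) _ Ps uPs Ps⇔ x t = begin
  sumOver R (weight S) Ps                            ≈⟨ sumOver-↭ (weight S) (enumeration uPs Ps⇔) ⟩
  sumOver R (weight S) (map (decode S) (codes S k))  ≡⟨ sumOver-map (weight S) (decode S) (codes S k) ⟩
  sumOver R (weight S ∘ decode S) (codes S k)        ≈⟨ sumOver-cong (codes S k) decoded-weight ⟩
  sumOver R codeWeight (codes S k)                   ≈⟨ codes-sum k uS ⟩
  prodOver R (λ i → sumOver R x S ⊕ times R i t) (upTo k) ∎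
  where
  open CommutativeSemiring R using (_≈_; setoid) renaming (_+_ to _⊕_)
  open import Relation.Binary.Reasoning.Setoid setoid
  open Sums R
  open Weights R x t
  S = map suc (upTo (suc k))
  uS : Unique S
  uS = Unique.map⁺ ℕ.suc-injective (Unique.upTo⁺ (suc k))
  open Enumeration uS (trans (length-map suc (upTo (suc k))) (length-upTo (suc k)))
  decoded-weight : ∀ {c} → c ∈ codes S k → weight S (decode S c) ≈ codeWeight c
  decoded-weight c∈ = weight-decode _ uS (λ v∈ → v∈) uS (length-code c∈) (proj₁ (∈-codes⁻ k c∈))
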